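{- Let $p\equiv 1\pmod 6$ be a prime, $a\in\mathbb{F}_p^*$, and let $E$ be the elliptic curve $y^{2}=x^{3}+a^{3}$ over $\mathbb{F}_p$. Then (a) $a\in Q_p$ if and only if $E(\mathbb{F}_p)$ has $2$ or $8$ elements of order $3$; (b) $a\in Q_p'$ if and only if $E(\mathbb{F}_p)$ has no elements of order $3$.
   Context: $E(\mathbb{F}_p)$ is the group of $\mathbb{F}_p$-rational points of $E$ including the point at infinity. $Q_p$ is the set of quadratic residues (nonzero squares) modulo $p$, and $Q_p'$ the set of quadratic non-residues. -}

module Defs where

open import Data.Nat using (ℕ; zero; suc; _+_; _*_; _∸_; _^_; NonZero)
open import Data.Nat.DivMod using (_%_)
open import Data.Nat.Properties using (_≟_)
open import Data.List using (List; []; _∷_; upTo; filter; length; concatMap; map)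
open import Data.Product using (Σ; _×_; _,_)
open import Data.Empty using (⊥)
open import Relation.Nullary using (¬_; Dec; yes; no)
open import Relation.Nullary.Decidable using (_×-dec_; ¬?)
open import Relation.Binary.PropositionalEquality using (_≡_; _≢_; refl; cong₂)

module Fp (p : ℕ) .{{_ : NonZero p}} where

  infixl 6 _⊕_ _⊖_
  infixl 7 _⊗_

  _⊕_ : ℕ → ℕ → ℕ
  x ⊕ y = (x + y) % p

  _⊗_ : ℕ → ℕ → ℕ
  x ⊗ y = (x * y) % p

  _⊖_ : ℕ → ℕ → ℕ
  x ⊖ y = (x % p + (p ∸ y % p)) % p

  -- multiplicative inverse in F_p (p prime) via Fermat: x⁻¹ = x^(p-2)
  inv : ℕ → ℕ
  inv x = (x ^ (p ∸ 2)) % p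

  _⊘_ : ℕ → ℕ → ℕ
  x ⊘ y = x ⊗ inv y

  data Pt : Set where
    ∞   : Pt
    aff : ℕ → ℕ → Pt

  -- Chord–tangent group law on y² = x³ + b (Weierstrass, A = 0).
  _+E_ : Pt → Pt → Pt
  ∞ +E Q = Q
  P +E ∞ = P
  aff x₁ y₁ +E aff x₂ y₂ with x₁ % p ≟ x₂ % p
  ... | no _ = let l = (y₂ ⊖ y₁) ⊘ (x₂ ⊖ x₁)
                   x₃ = (l ⊗ l) ⊖ x₁ ⊖ x₂
               in aff x₃ ((l ⊗ (x₁ ⊖ x₃)) ⊖ y₁)
  ... | yes _ with (y₁ + y₂) % p ≟ 0
  ...   | yes _ = ∞
  ...   | no _ = let l = (3 ⊗ x₁ ⊗ x₁) ⊘ (2 ⊗ y₁)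
                     x₃ = (l ⊗ l) ⊖ x₁ ⊖ x₂
                 in aff x₃ ((l ⊗ (x₁ ⊖ x₃)) ⊖ y₁)

  triple : Pt → Pt
  triple P = P +E (P +E P)

  _≟P_ : (P Q : Pt) → Dec (P ≡ Q)
  ∞ ≟P ∞ = yes refl
  ∞ ≟P aff _ _ = no λ ()
  aff _ _ ≟P ∞ = no λ ()
  aff x y ≟P aff x' y' with x ≟ x' | y ≟ y'
  ... | yes refl | yes refl = yes refl
  ... | no ne | _ = no λ { refl → ne refl }
  ... | _ | no ne = no λ { refl → ne refl }

  -- P has order 3 : P ≠ O and 3P = O (3 is prime)
  HasOrder3 : Pt → Set
  HasOrder3 P = P ≢ ∞ × triple P ≡ ∞

  hasOrder3? : (P : Pt) → Dec (HasOrder3 P)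
  hasOrder3? P = ¬? (P ≟P ∞) ×-dec (triple P ≟P ∞)

  points : ℕ → List Pt
  points b = ∞ ∷ map (λ { (x , y) → aff x y })
                     (filter (λ { (x , y) → (y * y) % p ≟ (x * x * x + b) % p })
                        (concatMap (λ x → map (x ,_) (upTo p)) (upTo p)))

  numOrder3 : ℕ → ℕ
  numOrder3 b = length (filter hasOrder3? (points b))

  IsQR : ℕ → Set
  IsQR a = (a % p ≢ 0) × Σ ℕ (λ x → (x * x) % p ≡ a % p)

  IsQNR : ℕ → Set
  IsQNR a = (a % p ≢ 0) × ¬ Σ ℕ (λ x → (x * x) % p ≡ a % p)

{-# OPTIONS --safe #-}
module Submission where

-- A point P = (x, y) of y² = x³ + b has order 3 iff the tangent at P meets the curve again
-- at P itself; eliminating the slope λ = 3x²/2y this is x(x³ + 4b) = 0.  So the points of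
-- order 3 are the square roots of b above x = 0, and the square roots of -3b above each of
-- the roots of x³ = -4b.  As p ≡ 1 (mod 6) there is a primitive cube root of unity ω
-- (X^((p-1)/3) - 1 has at most (p-1)/3 roots, so t^((p-1)/3) ≠ 1 for some t), hence
-- x³ = -4b has 0 or 3 roots and -3 = (2ω + 1)² is a square.  For b = a³ both b and -3b are
-- squares exactly when a is: 2 + 2·{0, 3} points of order 3 for a ∈ Q_p and none for a ∈ Q_p'.

open import Defs

open import Data.Nat as ℕ using (ℕ; NonZero; zero; suc; z≤n; s≤s; _^_)
import Data.Nat.Properties as ℕ
import Data.Nat.Divisibility as ℕ
open import Data.Nat.DivMod using (_%_; _/_; m%n<n; m/n*n≡m; m≡m%n+[m/n]*n)
open import Data.Nat.Primality using (Prime; euclidsLemma; prime⇒nonTrivial)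
open import Data.Nat.Combinatorics using (_C_; nCn≡1; nCk≡nC[n∸k]; k![n∸k]!∣n!; nCk≡n!/k![n-k]!)
open import Data.Nat.ListAction using (sum)
import Data.Nat.Tactic.RingSolver as ℕSolver
open import Data.Integer as ℤ using (ℤ; +_; -_; _+_; _-_; _*_; 0ℤ; 1ℤ; -1ℤ)
import Data.Integer.Properties as ℤ
open import Data.Integer.DivMod using (_%ℕ_; _/ℕ_; n%ℕd<d; a≡a%ℕn+[a/ℕn]*n)
open import Data.Integer.Divisibility.Signed
  using (_∣_; divides; _∣?_; ∣m∣n⇒∣m+n; ∣m⇒∣-m; ∣n⇒∣m*n; ∣m⇒∣m*n; ∣⇒∣ᵤ; ∣ᵤ⇒∣)
open import Data.Integer.Tactic.RingSolver using (solve-∀)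
open import Data.Fin as Fin using (Fin; toℕ; fromℕ; inject₁)
import Data.Fin.Properties as Fin
open import Data.List using (List; []; _∷_; _++_; [_]; length; drop; applyUpTo; upTo; map; filter; concatMap)
import Data.List.Properties as List
open import Data.List.Membership.DecPropositional ℕ._≟_ using (_∈_; _∈?_)
open import Data.List.Relation.Unary.All as All using (All; []; _∷_)
import Data.List.Relation.Unary.All.Properties as AllP
open import Data.List.Relation.Unary.AllPairs using (AllPairs; []; _∷_)
import Data.List.Relation.Unary.AllPairs.Properties as AllPairsP
open import Data.List.Relation.Unary.Any as AnyR using (here; there)
import Data.List.Relation.Unary.Any.Properties as Any
open import Data.Bool using (if_then_else_)
open import Data.Product using (Σ; _×_; _,_; proj₁; proj₂)
open import Data.Sum as Sum using (_⊎_; inj₁; inj₂; [_,_]′)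
open import Data.Empty using (⊥-elim)
open import Level using (0ℓ)
open import Algebra.Bundles using (CommutativeSemiring)
import Algebra.Properties.CommutativeSemiring.Binomial as Binomial
import Algebra.Properties.Monoid.Sum as MonoidSum
import Algebra.Definitions.RawMonoid as RawMonoid
import Algebra.Properties.Semiring.Exp as SemiringExp
open import Function using (id; _∘_)
open import Function.Bundles using (_⇔_; mk⇔; Equivalence)
open import Function.Properties.Equivalence using () renaming (trans to ⇔-trans)
open import Relation.Nullary using (¬_; Dec; yes; no; does)
open import Relation.Nullary.Decidable using (map′; _×-dec_; _⊎-dec_)
open import Relation.Unary using (Pred; Decidable)
open import Relation.Unary.Properties using (_∪?_; _∩?_)
open import Relation.Binary.Bundles using (Setoid)
open import Relation.Binary.Structures using (IsEquivalence)
import Relation.Binary.Reasoning.Setoid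
open import Relation.Binary.PropositionalEquality
  using (_≡_; _≢_; refl; sym; trans; cong; cong₂; subst; module ≡-Reasoning)

module Counting where

  private variable
    A B : Set

  count : {P : Pred A 0ℓ} → Decidable P → List A → ℕ
  count P? xs = length (filter P? xs)

  indicator : {S : Set} → Dec S → ℕ → ℕ
  indicator S? c = if does S? then c else 0

  module _ {P Q : Pred A 0ℓ} (P? : Decidable P) (Q? : Decidable Q) where

    count-cong : ∀ {xs} → All (λ x → P x ⇔ Q x) xs → count P? xs ≡ count Q? xs
    count-cong [] = refl
    count-cong {x ∷ xs} (P⇔Q ∷ rest) with P? x | Q? x
    ... | yes _  | yes _  = cong suc (count-cong rest)
    ... | no _   | no _   = count-cong rest
    ... | yes px | no ¬qx = ⊥-elim (¬qx (Equivalence.to P⇔Q px))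
    ... | no ¬px | yes qx = ⊥-elim (¬px (Equivalence.from P⇔Q qx))

    count-∪ : ∀ {xs} → All (λ x → ¬ (P x × Q x)) xs → count (P? ∪? Q?) xs ≡ count P? xs ℕ.+ count Q? xs
    count-∪ [] = refl
    count-∪ {x ∷ xs} (disjoint ∷ rest) with P? x | Q? x
    ... | yes px | yes qx = ⊥-elim (disjoint (px , qx))
    ... | yes _  | no _   = cong suc (count-∪ rest)
    ... | no _   | yes _  = trans (cong suc (count-∪ rest)) (sym (ℕ.+-suc _ _))
    ... | no _   | no _   = count-∪ rest

    count-filter : ∀ xs → count Q? (filter P? xs) ≡ count (P? ∩? Q?) xs
    count-filter [] = refl
    count-filter (x ∷ xs) with P? x
    ... | no _ = count-filter xs
    ... | yes _ with Q? x
    ...   | yes _ = cong suc (count-filter xs)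
    ...   | no _  = count-filter xs

  count-none : ∀ {P : Pred A 0ℓ} (P? : Decidable P) {xs} → All (¬_ ∘ P) xs → count P? xs ≡ 0
  count-none P? ¬P = cong length (List.filter-none P? ¬P)

  count-accept : ∀ {P : Pred A 0ℓ} (P? : Decidable P) {x} xs → P x → count P? (x ∷ xs) ≡ suc (count P? xs)
  count-accept P? xs px = cong length (List.filter-accept P? px)

  count-reject : ∀ {P : Pred A 0ℓ} (P? : Decidable P) {x} xs → ¬ P x → count P? (x ∷ xs) ≡ count P? xs
  count-reject P? xs ¬px = cong length (List.filter-reject P? ¬px)

  count-++ : ∀ {P : Pred A 0ℓ} (P? : Decidable P) xs ys → count P? (xs ++ ys) ≡ count P? xs ℕ.+ count P? ys
  count-++ P? xs ys = trans (cong length (List.filter-++ P? xs ys)) (List.length-++ (filter P? xs))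

  count-guarded : ∀ {S : Set} {Q : Pred A 0ℓ} (S? : Dec S) (Q? : Decidable Q) xs →
                  count (λ x → S? ×-dec Q? x) xs ≡ indicator S? (count Q? xs)
  count-guarded (no ¬s) Q? xs = count-none _ (All.universal (λ _ → ¬s ∘ proj₁) xs)
  count-guarded (yes s) Q? [] = refl
  count-guarded (yes s) Q? (x ∷ xs) with Q? x
  ... | yes _ = cong suc (count-guarded (yes s) Q? xs)
  ... | no _  = count-guarded (yes s) Q? xs

  sum-cong : ∀ (f g : A → ℕ) {xs} → All (λ x → f x ≡ g x) xs → sum (map f xs) ≡ sum (map g xs)
  sum-cong f g [] = refl
  sum-cong f g (e ∷ es) = cong₂ ℕ._+_ e (sum-cong f g es)

  sum-+ : ∀ (f g : A → ℕ) xs → sum (map (λ x → f x ℕ.+ g x) xs) ≡ sum (map f xs) ℕ.+ sum (map g xs)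
  sum-+ f g [] = refl
  sum-+ f g (x ∷ xs) = trans (cong (f x ℕ.+ g x ℕ.+_) (sum-+ f g xs)) (lemma (f x) (g x) _ _)
    where lemma : ∀ a b c d → a ℕ.+ b ℕ.+ (c ℕ.+ d) ≡ a ℕ.+ c ℕ.+ (b ℕ.+ d)
          lemma = ℕSolver.solve-∀

  sum-indicator : ∀ {Q : Pred A 0ℓ} (Q? : Decidable Q) c xs → sum (map (λ x → indicator (Q? x) c) xs) ≡ count Q? xs ℕ.* c
  sum-indicator Q? c [] = refl
  sum-indicator Q? c (x ∷ xs) with Q? x
  ... | yes _ = cong (c ℕ.+_) (sum-indicator Q? c xs)
  ... | no _  = sum-indicator Q? c xs

  indicator-cong : ∀ {S T : Set} (S? : Dec S) (T? : Dec T) {c d} → S ⇔ T → (S → c ≡ d) → indicator S? c ≡ indicator T? d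
  indicator-cong (yes s) (yes _) S⇔T c≡d = c≡d s
  indicator-cong (no _)  (no _)  S⇔T c≡d = refl
  indicator-cong (yes s) (no ¬t) S⇔T c≡d = ⊥-elim (¬t (Equivalence.to S⇔T s))
  indicator-cong (no ¬s) (yes t) S⇔T c≡d = ⊥-elim (¬s (Equivalence.from S⇔T t))

  indicator-⊎ : ∀ {S T : Set} (S? : Dec S) (T? : Dec T) c → ¬ (S × T) → indicator (S? ⊎-dec T?) c ≡ indicator S? c ℕ.+ indicator T? c
  indicator-⊎ (yes s) (yes t) c disjoint = ⊥-elim (disjoint (s , t))
  indicator-⊎ (yes _) (no _)  c disjoint = sym (ℕ.+-identityʳ c)
  indicator-⊎ (no _)  (yes _) c disjoint = refl
  indicator-⊎ (no _)  (no _)  c disjoint = refl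

  count-map : ∀ {P : Pred B 0ℓ} (P? : Decidable P) (f : A → B) xs → count P? (map f xs) ≡ count (P? ∘ f) xs
  count-map P? f [] = refl
  count-map P? f (x ∷ xs) with P? (f x)
  ... | yes _ = cong suc (count-map P? f xs)
  ... | no _  = count-map P? f xs

  count-concatMap : ∀ {P : Pred B 0ℓ} (P? : Decidable P) (f : A → List B) xs →
                    count P? (concatMap f xs) ≡ sum (map (count P? ∘ f) xs)
  count-concatMap P? f [] = refl
  count-concatMap P? f (x ∷ xs) = trans (count-++ P? (f x) (concatMap f xs)) (cong (count P? (f x) ℕ.+_) (count-concatMap P? f xs))

  count-grid : ∀ {A B : Set} {C : Pred (A × A) 0ℓ} {P : Pred B 0ℓ} (C? : Decidable C) (P? : Decidable P) (F : A × A → B) xs →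
               count P? (map F (filter C? (concatMap (λ x → map (x ,_) xs) xs)))
                 ≡ sum (map (λ x → count (λ y → C? (x , y) ×-dec P? (F (x , y))) xs) xs)
  count-grid {A} C? P? F xs = begin
    count P? (map F (filter C? grid))                            ≡⟨ count-map P? F (filter C? grid) ⟩
    count (P? ∘ F) (filter C? grid)                              ≡⟨ count-filter C? (P? ∘ F) grid ⟩
    count (C? ∩? (P? ∘ F)) grid                                  ≡⟨ count-concatMap (C? ∩? (P? ∘ F)) row xs ⟩
    sum (map (λ x → count (C? ∩? (P? ∘ F)) (row x)) xs)
      ≡⟨ sum-cong _ _ (All.universal (λ x → count-map (C? ∩? (P? ∘ F)) (x ,_) xs) xs) ⟩
    sum (map (λ x → count (λ y → C? (x , y) ×-dec P? (F (x , y))) xs) xs) ∎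
    where
      open ≡-Reasoning
      row : A → List (A × A)
      row x = map (x ,_) xs
      grid : List (A × A)
      grid = concatMap row xs

  count-≡-upTo : ∀ {n u} → u ℕ.< n → count (ℕ._≟ u) (upTo n) ≡ 1
  count-≡-upTo {suc n} {u} u<1+n = begin
    count (ℕ._≟ u) (upTo (suc n))                   ≡⟨ cong (count (ℕ._≟ u)) (List.upTo-∷ʳ n) ⟨
    count (ℕ._≟ u) (upTo n ++ [ n ])                ≡⟨ count-++ (ℕ._≟ u) (upTo n) [ n ] ⟩
    count (ℕ._≟ u) (upTo n) ℕ.+ count (ℕ._≟ u) [ n ] ≡⟨ last-or-earlier (n ℕ.≟ u) ⟩
    1                                                ∎
    where
      open ≡-Reasoning
      last-or-earlier : Dec (n ≡ u) → count (ℕ._≟ u) (upTo n) ℕ.+ count (ℕ._≟ u) [ n ] ≡ 1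
      last-or-earlier (yes refl) = cong₂ ℕ._+_ (count-none (ℕ._≟ u) (All.map (λ x<n x≡n → ℕ.<-irrefl x≡n x<n) (AllP.all-upTo n)))
                                               (count-accept (ℕ._≟ u) [] refl)
      last-or-earlier (no n≢u) =
        cong₂ ℕ._+_ (count-≡-upTo (ℕ.≤∧≢⇒< (ℕ.≤-pred u<1+n) (n≢u ∘ sym))) (count-reject (ℕ._≟ u) [] n≢u)

  count-upTo-≡-length : ∀ {n} {P : Pred ℕ 0ℓ} (P? : Decidable P) (rs : List ℕ) → AllPairs _≢_ rs → All (ℕ._< n) rs →
                        (∀ {x} → x ℕ.< n → P x ⇔ x ∈ rs) → count P? (upTo n) ≡ length rs
  count-upTo-≡-length {n} P? rs distinct rs<n P⇔∈ = trans
    (count-cong P? (_∈? rs) (All.map P⇔∈ (AllP.all-upTo n)))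
    (count-∈ rs distinct rs<n)
    where
      count-∈ : ∀ rs → AllPairs _≢_ rs → All (ℕ._< n) rs → count (_∈? rs) (upTo n) ≡ length rs
      count-∈ [] _ _ = count-none (_∈? []) (All.universal (λ _ ()) (upTo n))
      count-∈ (r ∷ rs) (r∉rs ∷ distinct) (r<n ∷ rs<n) = begin
        count (_∈? r ∷ rs) (upTo n)
          ≡⟨ count-cong (_∈? r ∷ rs) ((ℕ._≟ r) ∪? (_∈? rs)) (All.universal (λ _ → ∈-∷⇔) (upTo n)) ⟩
        count ((ℕ._≟ r) ∪? (_∈? rs)) (upTo n)                 ≡⟨ count-∪ (ℕ._≟ r) (_∈? rs) (All.universal r-not-in-rs (upTo n)) ⟩
        count (ℕ._≟ r) (upTo n) ℕ.+ count (_∈? rs) (upTo n)    ≡⟨ cong₂ ℕ._+_ (count-≡-upTo r<n) (count-∈ rs distinct rs<n) ⟩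
        suc (length rs)                                       ∎
        where
          open ≡-Reasoning
          ∈-∷⇔ : ∀ {x} → x ∈ r ∷ rs ⇔ (x ≡ r ⊎ x ∈ rs)
          ∈-∷⇔ = mk⇔ (λ { (here x≡r) → inj₁ x≡r ; (there x∈rs) → inj₂ x∈rs }) [ here , there ]′
          r-not-in-rs : ∀ x → ¬ (x ≡ r × x ∈ rs)
          r-not-in-rs x (refl , x∈rs) = All.lookup r∉rs x∈rs refl

pos-cube : ∀ n → + n * + n * + n ≡ + (n ℕ.* n ℕ.* n)
pos-cube n = trans (cong (_* + n) (sym (ℤ.pos-* n n))) (sym (ℤ.pos-* (n ℕ.* n) n))

-- Polynomials over ℤ as coefficient lists, constant coefficient first.
module Polynomial where

  eval : List ℤ → ℤ → ℤ
  eval [] x = 0ℤ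
  eval (c ∷ cs) x = c + x * eval cs x

  -- Synthetic division: c ∷ cs = (X - r) * quotient r cs + eval (c ∷ cs) r.
  quotient : ℤ → List ℤ → List ℤ
  quotient r [] = []
  quotient r (d ∷ ds) = eval (d ∷ ds) r ∷ quotient r ds

  length-quotient : ∀ r cs → length (quotient r cs) ≡ length cs
  length-quotient r [] = refl
  length-quotient r (d ∷ ds) = cong suc (length-quotient r ds)

  eval-factor : ∀ r c cs x → eval (c ∷ cs) x - eval (c ∷ cs) r ≡ (x - r) * eval (quotient r cs) x
  eval-factor r c [] x = lemma c x r
    where lemma : ∀ c x r → c + x * 0ℤ - (c + r * 0ℤ) ≡ (x - r) * 0ℤ
          lemma = solve-∀
  eval-factor r c (d ∷ ds) x = begin
    eval (c ∷ d ∷ ds) x - eval (c ∷ d ∷ ds) r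
      ≡⟨ lemma₁ c d x r (eval ds x) (eval ds r) ⟩
    x * (eval (d ∷ ds) x - eval (d ∷ ds) r) + (x - r) * eval (d ∷ ds) r
      ≡⟨ cong (λ t → x * t + (x - r) * eval (d ∷ ds) r) (eval-factor r d ds x) ⟩
    x * ((x - r) * eval (quotient r ds) x) + (x - r) * eval (d ∷ ds) r
      ≡⟨ lemma₂ x r (eval (d ∷ ds) r) (eval (quotient r ds) x) ⟩
    (x - r) * eval (quotient r (d ∷ ds)) x
      ∎
    where
      open ≡-Reasoning
      lemma₁ : ∀ c d x r E Eʳ → c + x * (d + x * E) - (c + r * (d + r * Eʳ)) ≡ x * ((d + x * E) - (d + r * Eʳ)) + (x - r) * (d + r * Eʳ)
      lemma₁ = solve-∀
      lemma₂ : ∀ x r e Q → x * ((x - r) * Q) + (x - r) * e ≡ (x - r) * (e + x * Q)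
      lemma₂ = solve-∀

  monomial : ℕ → List ℤ
  monomial zero = 1ℤ ∷ []
  monomial (suc k) = 0ℤ ∷ monomial k

  length-monomial : ∀ k → length (monomial k) ≡ suc k
  length-monomial zero = refl
  length-monomial (suc k) = cong suc (length-monomial k)

  eval-monomial : ∀ k t → eval (monomial k) (+ t) ≡ + (t ^ k)
  eval-monomial zero t = cong (λ e → 1ℤ + e) (ℤ.*-zeroʳ (+ t))
  eval-monomial (suc k) t = begin
    0ℤ + + t * eval (monomial k) (+ t)    ≡⟨ ℤ.+-identityˡ _ ⟩
    + t * eval (monomial k) (+ t)         ≡⟨ cong (+ t *_) (eval-monomial k t) ⟩
    + t * + (t ^ k)                       ≡⟨ ℤ.pos-* t (t ^ k) ⟨
    + (t ^ suc k)                         ∎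
    where open ≡-Reasoning

module Congruence (p : ℕ) {{_ : NonZero p}} where

  open Fp p using (_⊗_; _⊖_)

  infix 4 _≋_ _≋?_ _≉_

  -- A record rather than the bare divisibility, so that a and b stay inferable.
  record _≋_ (a b : ℤ) : Set where
    constructor mk≋
    field p∣a-b : + p ∣ a - b
  open _≋_ public

  _≉_ : ℤ → ℤ → Set
  a ≉ b = ¬ a ≋ b

  _≋?_ : (a b : ℤ) → Dec (a ≋ b)
  a ≋? b = map′ mk≋ p∣a-b (+ p ∣? a - b)

  private
    p∣-resp : ∀ {x y} → x ≡ y → + p ∣ x → + p ∣ y
    p∣-resp = subst (+ p ∣_)

  ≋-reflexive : ∀ {a b} → a ≡ b → a ≋ b
  ≋-reflexive {a} refl = mk≋ (divides 0ℤ (ℤ.+-inverseʳ a))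

  ≋-refl : ∀ {a} → a ≋ a
  ≋-refl = ≋-reflexive refl

  ≋-sym : ∀ {a b} → a ≋ b → b ≋ a
  ≋-sym {a} {b} (mk≋ d) = mk≋ (p∣-resp (lemma a b) (∣m⇒∣-m d))
    where lemma : ∀ a b → - (a - b) ≡ b - a
          lemma = solve-∀

  ≋-trans : ∀ {a b c} → a ≋ b → b ≋ c → a ≋ c
  ≋-trans {a} {b} {c} (mk≋ d) (mk≋ e) = mk≋ (p∣-resp (lemma a b c) (∣m∣n⇒∣m+n d e))
    where lemma : ∀ a b c → (a - b) + (b - c) ≡ a - c
          lemma = solve-∀

  ≋-isEquivalence : IsEquivalence _≋_
  ≋-isEquivalence = record { refl = ≋-refl ; sym = ≋-sym ; trans = ≋-trans }

  ≋-setoid : Setoid _ _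
  ≋-setoid = record { isEquivalence = ≋-isEquivalence }

  module ≋-Reasoning = Relation.Binary.Reasoning.Setoid ≋-setoid

  ≋-rhs⇔ : ∀ {a b c} → b ≋ c → (a ≋ b) ⇔ (a ≋ c)
  ≋-rhs⇔ b≋c = mk⇔ (λ a≋b → ≋-trans a≋b b≋c) (λ a≋c → ≋-trans a≋c (≋-sym b≋c))

  +-cong : ∀ {a b c d} → a ≋ b → c ≋ d → a + c ≋ b + d
  +-cong {a} {b} {c} {d} (mk≋ x) (mk≋ y) = mk≋ (p∣-resp (lemma a b c d) (∣m∣n⇒∣m+n x y))
    where lemma : ∀ a b c d → (a - b) + (c - d) ≡ (a + c) - (b + d)
          lemma = solve-∀

  -‿cong : ∀ {a b} → a ≋ b → - a ≋ - b
  -‿cong {a} {b} (mk≋ x) = mk≋ (p∣-resp (lemma a b) (∣m⇒∣-m x))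
    where lemma : ∀ a b → - (a - b) ≡ (- a) - (- b)
          lemma = solve-∀

  -cong : ∀ {a b c d} → a ≋ b → c ≋ d → a - c ≋ b - d
  -cong a≋b c≋d = +-cong a≋b (-‿cong c≋d)

  *-cong : ∀ {a b c d} → a ≋ b → c ≋ d → a * c ≋ b * d
  *-cong {a} {b} {c} {d} (mk≋ x) (mk≋ y) =
    mk≋ (p∣-resp (lemma a b c d) (∣m∣n⇒∣m+n (∣n⇒∣m*n a y) (∣m⇒∣m*n d x)))
    where lemma : ∀ a b c d → a * (c - d) + (a - b) * d ≡ a * c - b * d
          lemma = solve-∀

  ≋-diff : ∀ {a b} → a - b ≋ 0ℤ → a ≋ b
  ≋-diff {a} {b} d = ≋-trans (≋-reflexive (lemma a b)) (≋-trans (+-cong d ≋-refl) (≋-reflexive (ℤ.+-identityˡ b)))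
    where lemma : ∀ a b → a ≡ (a - b) + b
          lemma = solve-∀

  diff-≋ : ∀ {a b} → a ≋ b → a - b ≋ 0ℤ
  diff-≋ {a} {b} d = ≋-trans (-cong d ≋-refl) (≋-reflexive (ℤ.+-inverseʳ b))

  ≋0⇒∣ : ∀ {a} → a ≋ 0ℤ → + p ∣ a
  ≋0⇒∣ {a} (mk≋ d) = p∣-resp (ℤ.+-identityʳ a) d

  ∣⇒≋0 : ∀ {a} → + p ∣ a → a ≋ 0ℤ
  ∣⇒≋0 {a} d = mk≋ (p∣-resp (sym (ℤ.+-identityʳ a)) d)

  p≋0 : + p ≋ 0ℤ
  p≋0 = ∣⇒≋0 (divides 1ℤ (sym (ℤ.*-identityˡ (+ p))))

  *-zeroʳ-≋ : ∀ k {a} → a ≋ 0ℤ → k * a ≋ 0ℤ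
  *-zeroʳ-≋ k {a} a≋0 = ≋-trans (*-cong (≋-refl {k}) a≋0) (≋-reflexive (ℤ.*-zeroʳ k))

  rep : ℤ → ℕ
  rep z = z %ℕ p

  rep<p : ∀ z → rep z ℕ.< p
  rep<p z = n%ℕd<d z p

  rep≋ : ∀ z → + rep z ≋ z
  rep≋ z = ≋-sym (mk≋ (divides (z /ℕ p) (begin
    z - + rep z                          ≡⟨ cong (λ t → t - + rep z) (a≡a%ℕn+[a/ℕn]*n z p) ⟩
    (+ rep z + z /ℕ p * + p) - + rep z   ≡⟨ lemma (+ rep z) (z /ℕ p * + p) ⟩
    z /ℕ p * + p                         ∎)))
    where
      open ≡-Reasoning
      lemma : ∀ r k → (r + k) - r ≡ k
      lemma = solve-∀

  %≋ : ∀ n → + (n % p) ≋ + n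
  %≋ n = rep≋ (+ n)

  private
    ≋-≥⇒≡ : ∀ {u v} → v ℕ.≤ u → u ℕ.< p → + u ≋ + v → u ≡ v
    ≋-≥⇒≡ {u} {v} v≤u u<p (mk≋ d) = ℕ.≤-antisym (ℕ.m∸n≡0⇒m≤n u∸v≡0) v≤u
      where
        p∣u∸v : p ℕ.∣ u ℕ.∸ v
        p∣u∸v = ∣⇒∣ᵤ (p∣-resp (trans (ℤ.m-n≡m⊖n u v) (ℤ.⊖-≥ v≤u)) d)
        u∸v≡0 : u ℕ.∸ v ≡ 0
        u∸v≡0 with u ℕ.∸ v in eq
        ... | zero = refl
        ... | suc _ = ⊥-elim (ℕ.>⇒∤ (subst (ℕ._< p) eq (ℕ.≤-<-trans (ℕ.m∸n≤m u v) u<p)) (subst (p ℕ.∣_) eq p∣u∸v))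

  ≋⇒≡ : ∀ {u v} → u ℕ.< p → v ℕ.< p → + u ≋ + v → u ≡ v
  ≋⇒≡ {u} {v} u<p v<p u≋v with ℕ.≤-total u v
  ... | inj₁ u≤v = sym (≋-≥⇒≡ u≤v v<p (≋-sym u≋v))
  ... | inj₂ v≤u = ≋-≥⇒≡ v≤u u<p u≋v

  ≋⇒≡rep : ∀ {y z} → y ℕ.< p → + y ≋ z → y ≡ rep z
  ≋⇒≡rep {y} {z} y<p y≋z = ≋⇒≡ y<p (rep<p z) (≋-trans y≋z (≋-sym (rep≋ z)))

  %≡⇒≋ : ∀ {x y} → x % p ≡ y % p → + x ≋ + y
  %≡⇒≋ {x} {y} e = ≋-trans (≋-sym (%≋ x)) (≋-trans (≋-reflexive (cong +_ e)) (%≋ y))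

  ≋⇒%≡ : ∀ {x y} → + x ≋ + y → x % p ≡ y % p
  ≋⇒%≡ {x} {y} d = ≋⇒≡ (m%n<n x p) (m%n<n y p) (≋-trans (%≋ x) (≋-trans d (≋-sym (%≋ y))))

  %≡0⇒≋0 : ∀ {x} → x % p ≡ 0 → + x ≋ 0ℤ
  %≡0⇒≋0 {x} e = ≋-trans (≋-sym (%≋ x)) (≋-reflexive (cong +_ e))

  ≋0⇒%≡0 : ∀ {x} → + x ≋ 0ℤ → x % p ≡ 0
  ≋0⇒%≡0 {x} d = ≋⇒≡ (m%n<n x p) (ℕ.>-nonZero⁻¹ p) (≋-trans (%≋ x) d)

  ⊗≋* : ∀ x y → + (x ⊗ y) ≋ + x * + y
  ⊗≋* x y = ≋-trans (%≋ (x ℕ.* y)) (≋-reflexive (ℤ.pos-* x y))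

  ⊖≋- : ∀ x y → + (x ⊖ y) ≋ + x - + y
  ⊖≋- x y = begin
    + (x ⊖ y)                              ≈⟨ %≋ _ ⟩
    + (x % p ℕ.+ (p ℕ.∸ y % p))            ≡⟨ ℤ.pos-+ (x % p) (p ℕ.∸ y % p) ⟩
    + (x % p) + + (p ℕ.∸ y % p)            ≡⟨ cong (λ t → + (x % p) + t) p∸y≡p-y ⟨
    + (x % p) + (+ p - + (y % p))          ≈⟨ +-cong (%≋ x) (-cong p≋0 (%≋ y)) ⟩
    + x + (0ℤ - + y)                       ≡⟨ lemma (+ x) (+ y) ⟩
    + x - + y                              ∎
    where
      open ≋-Reasoning
      p∸y≡p-y : + p - + (y % p) ≡ + (p ℕ.∸ y % p)
      p∸y≡p-y = trans (ℤ.m-n≡m⊖n p (y % p)) (ℤ.⊖-≥ (ℕ.<⇒≤ (m%n<n y p)))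
      lemma : ∀ a b → a + (0ℤ - b) ≡ a - b
      lemma = solve-∀

module PrimeField (p : ℕ) {{_ : NonZero p}} (p-prime : Prime p) where
  open Congruence p

  instance
    p-nonTrivial : ℕ.NonTrivial p
    p-nonTrivial = prime⇒nonTrivial p-prime

  ≋0-product : ∀ {a b} → a * b ≋ 0ℤ → a ≋ 0ℤ ⊎ b ≋ 0ℤ
  ≋0-product {a} {b} ab≋0 =
    Sum.map (∣⇒≋0 ∘ ∣ᵤ⇒∣) (∣⇒≋0 ∘ ∣ᵤ⇒∣)
      (euclidsLemma ℤ.∣ a ∣ ℤ.∣ b ∣ p-prime (subst (p ℕ.∣_) (ℤ.abs-* a b) (∣⇒∣ᵤ (≋0⇒∣ ab≋0))))

  *-≉0 : ∀ {a b} → a ≉ 0ℤ → b ≉ 0ℤ → a * b ≉ 0ℤ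
  *-≉0 a≉0 b≉0 ab≋0 = [ a≉0 , b≉0 ]′ (≋0-product ab≋0)

  *-cancelˡ-≋ : ∀ {a u v} → a ≉ 0ℤ → a * u ≋ a * v → u ≋ v
  *-cancelˡ-≋ {a} {u} {v} a≉0 au≋av =
    [ ⊥-elim ∘ a≉0 , ≋-diff ]′ (≋0-product (≋-trans (≋-reflexive (lemma a u v)) (diff-≋ au≋av)))
    where lemma : ∀ a u v → a * (u - v) ≡ a * u - a * v
          lemma = solve-∀

  ≋-square-roots : ∀ {s y} → y * y ≋ s * s → y ≋ s ⊎ y ≋ - s
  ≋-square-roots {s} {y} y²≋s² =
    Sum.map ≋-diff (λ y+s≋0 → ≋-diff (≋-trans (≋-reflexive (lemma₂ y s)) y+s≋0))
      (≋0-product (≋-trans (≋-reflexive (lemma₁ y s)) (diff-≋ y²≋s²)))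
    where lemma₁ : ∀ y s → (y - s) * (y + s) ≡ y * y - s * s
          lemma₁ = solve-∀
          lemma₂ : ∀ y s → y - - s ≡ y + s
          lemma₂ = solve-∀

  <p⇒≉0 : ∀ {k} → 0 ℕ.< k → k ℕ.< p → + k ≉ 0ℤ
  <p⇒≉0 {suc k} _ k<p k≋0 with ≋⇒≡ k<p (ℕ.>-nonZero⁻¹ p) k≋0
  ... | ()

  1≉0 : 1ℤ ≉ 0ℤ
  1≉0 = <p⇒≉0 ℕ.z<s (ℕ.nonTrivial⇒n>1 p)

module Fermat (p : ℕ) {{_ : NonZero p}} (p-prime : Prime p) where
  open Congruence p
  open PrimeField p p-prime

  private
    n∣n! : ∀ n → .{{NonZero n}} → n ℕ.∣ n ℕ.!
    n∣n! (suc n) = ℕ.m∣m*n (n ℕ.!)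

    p∤m! : ∀ {m} → m ℕ.< p → ¬ p ℕ.∣ m ℕ.!
    p∤m! {zero} _ p∣1 = ℕ.nonTrivial⇒≢1 (ℕ.∣1⇒≡1 p∣1)
    p∤m! {suc m} m<p p∣m! =
      [ ℕ.<⇒≱ m<p ∘ ℕ.∣⇒≤ , p∤m! (ℕ.<-trans (ℕ.n<1+n m) m<p) ]′ (euclidsLemma (suc m) (m ℕ.!) p-prime p∣m!)

  p∣pCk : ∀ {k} → 0 ℕ.< k → k ℕ.< p → p ℕ.∣ p C k
  p∣pCk {k} 0<k k<p =
    [ id , ⊥-elim ∘ p∤k![p∸k]! ]′ (euclidsLemma (p C k) (k ℕ.! ℕ.* (p ℕ.∸ k) ℕ.!) p-prime p∣pCk*k![p∸k]!)
    where
      k≤p : k ℕ.≤ p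
      k≤p = ℕ.<⇒≤ k<p
      p∤k![p∸k]! : ¬ p ℕ.∣ k ℕ.! ℕ.* (p ℕ.∸ k) ℕ.!
      p∤k![p∸k]! p∣ = [ p∤m! k<p , p∤m! (ℕ.∸-monoʳ-< 0<k k≤p) ]′ (euclidsLemma (k ℕ.!) ((p ℕ.∸ k) ℕ.!) p-prime p∣)
      instance
        _ : NonZero (k ℕ.! ℕ.* (p ℕ.∸ k) ℕ.!)
        _ = k ℕ.!* (p ℕ.∸ k) !≢0
      p∣pCk*k![p∸k]! : p ℕ.∣ (p C k) ℕ.* (k ℕ.! ℕ.* (p ℕ.∸ k) ℕ.!)
      p∣pCk*k![p∸k]! = subst (p ℕ.∣_)
        (sym (trans (cong (ℕ._* (k ℕ.! ℕ.* (p ℕ.∸ k) ℕ.!)) (nCk≡n!/k![n-k]! k≤p)) (m/n*n≡m (k![n∸k]!∣n! k≤p))))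
        (n∣n! p)

  private
    module ℕBinomial = Binomial ℕ.+-*-commutativeSemiring
    module ℕSum = MonoidSum ℕ.+-0-monoid
    open SemiringExp (CommutativeSemiring.semiring ℕ.+-*-commutativeSemiring) using () renaming (_^_ to _^ₛ_)
    open RawMonoid ℕ.+-0-rawMonoid using () renaming (_×_ to _×ₛ_)

    ^ₛ≡^ : ∀ x n → x ^ₛ n ≡ x ^ n
    ^ₛ≡^ x zero = refl
    ^ₛ≡^ x (suc n) = cong (x ℕ.*_) (^ₛ≡^ x n)

    ×ₛ≡* : ∀ n x → n ×ₛ x ≡ n ℕ.* x
    ×ₛ≡* zero x = refl
    ×ₛ≡* (suc n) x = cong (x ℕ.+_) (×ₛ≡* n x)

    p∣sum : ∀ {m} (f : Fin m → ℕ) → (∀ i → p ℕ.∣ f i) → p ℕ.∣ ℕSum.sum f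
    p∣sum {zero} f p∣f = p ℕ.∣0
    p∣sum {suc m} f p∣f = ℕ.∣m∣n⇒∣m+n (p∣f Fin.zero) (p∣sum (f ∘ Fin.suc) (p∣f ∘ Fin.suc))

    binomial-first : ∀ x n → ℕBinomial.binomialTerm x 1 n Fin.zero ≡ 1
    binomial-first x n = begin
      ℕBinomial.binomialTerm x 1 n Fin.zero  ≡⟨ ×ₛ≡* (n C 0) _ ⟩
      (n C 0) ℕ.* (1 ℕ.* 1 ^ₛ n)            ≡⟨ cong₂ ℕ._*_ (trans (nCk≡nC[n∸k] {k = 0} {n = n} z≤n) (nCn≡1 n)) (ℕ.*-identityˡ _) ⟩
      1 ℕ.* 1 ^ₛ n                          ≡⟨ trans (ℕ.*-identityˡ _) (^ₛ≡^ 1 n) ⟩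
      1 ^ n                                 ≡⟨ ℕ.^-zeroˡ n ⟩
      1                                     ∎
      where open ≡-Reasoning

    binomial-last : ∀ x q → ℕBinomial.binomialTerm x 1 (suc q) (Fin.suc (fromℕ q)) ≡ x ^ suc q
    binomial-last x q = begin
      ℕBinomial.binomialTerm x 1 n (Fin.suc (fromℕ q))     ≡⟨ ×ₛ≡* (n C suc top) _ ⟩
      (n C suc top) ℕ.* (x ^ₛ suc top ℕ.* 1 ^ₛ (n ℕ.∸ suc top))
        ≡⟨ cong (λ t → (n C suc t) ℕ.* (x ^ₛ suc t ℕ.* 1 ^ₛ (n ℕ.∸ suc t))) (Fin.toℕ-fromℕ q) ⟩
      (n C n) ℕ.* (x ^ₛ n ℕ.* 1 ^ₛ (n ℕ.∸ n))               ≡⟨ cong (ℕ._* (x ^ₛ n ℕ.* 1 ^ₛ (n ℕ.∸ n))) (nCn≡1 n) ⟩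
      1 ℕ.* (x ^ₛ n ℕ.* 1 ^ₛ (n ℕ.∸ n))                     ≡⟨ cong (λ e → 1 ℕ.* (x ^ₛ n ℕ.* 1 ^ₛ e)) (ℕ.n∸n≡0 n) ⟩
      1 ℕ.* (x ^ₛ n ℕ.* 1)                                 ≡⟨ trans (ℕ.*-identityˡ _) (ℕ.*-identityʳ _) ⟩
      x ^ₛ n                                               ≡⟨ ^ₛ≡^ x n ⟩
      x ^ n                                                ∎
      where
        open ≡-Reasoning
        n : ℕ
        n = suc q
        top : ℕ
        top = toℕ (fromℕ q)

    p∣binomial-middle : ∀ x q → suc q ≡ p → ∀ i → p ℕ.∣ ℕBinomial.binomialTerm x 1 (suc q) (Fin.suc (inject₁ i))
    p∣binomial-middle x q sq≡p i =
      subst (p ℕ.∣_) (sym (×ₛ≡* (suc q C k) b)) (ℕ.∣m⇒∣m*n b (subst (λ m → p ℕ.∣ m C k) (sym sq≡p) (p∣pCk ℕ.z<s k<p)))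
      where
        k : ℕ
        k = suc (toℕ (inject₁ i))
        b : ℕ
        b = ℕBinomial.binomial x 1 (suc q) (Fin.suc (inject₁ i))
        k<p : k ℕ.< p
        k<p = subst (k ℕ.<_) sq≡p (s≤s (subst (ℕ._< q) (sym (Fin.toℕ-inject₁ i)) (Fin.toℕ<n i)))

    -- Written for p = suc q to expose the first and last terms of the expansion.
    freshman′ : ∀ q → suc q ≡ p → ∀ x → + ((x ℕ.+ 1) ^ suc q) ≋ + (x ^ suc q) + 1ℤ
    freshman′ q sq≡p x = begin
      + ((x ℕ.+ 1) ^ n)                           ≡⟨ cong +_ (sym (^ₛ≡^ (x ℕ.+ 1) n)) ⟩
      + ((x ℕ.+ 1) ^ₛ n)                          ≡⟨ cong +_ (ℕBinomial.theorem n x 1) ⟩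
      + (term Fin.zero ℕ.+ ℕSum.sum (term ∘ Fin.suc))
        ≡⟨ cong (λ t → + (term Fin.zero ℕ.+ t)) (ℕSum.sum-init-last (term ∘ Fin.suc)) ⟩
      + (term Fin.zero ℕ.+ (middle ℕ.+ last))
        ≡⟨ trans (ℤ.pos-+ (term Fin.zero) (middle ℕ.+ last)) (cong (λ t → + term Fin.zero + t) (ℤ.pos-+ middle last)) ⟩
      + term Fin.zero + (+ middle + + last)
        ≈⟨ +-cong (≋-reflexive (cong +_ (binomial-first x n))) (+-cong middle≋0 (≋-reflexive (cong +_ (binomial-last x q)))) ⟩
      1ℤ + (0ℤ + + (x ^ n))                       ≡⟨ lemma (+ (x ^ n)) ⟩
      + (x ^ n) + 1ℤ                              ∎
      where
        open ≋-Reasoning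
        n : ℕ
        n = suc q
        term : Fin (suc n) → ℕ
        term = ℕBinomial.binomialTerm x 1 n
        middle : ℕ
        middle = ℕSum.sum (λ i → term (Fin.suc (inject₁ i)))
        last : ℕ
        last = term (Fin.suc (fromℕ q))
        lemma : ∀ a → 1ℤ + (0ℤ + a) ≡ a + 1ℤ
        lemma = solve-∀
        middle≋0 : + middle ≋ 0ℤ
        middle≋0 = ∣⇒≋0 (∣ᵤ⇒∣ (p∣sum _ (p∣binomial-middle x q sq≡p)))

  freshman : ∀ x → + (suc x ^ p) ≋ + (x ^ p) + 1ℤ
  freshman x = subst (λ n → + (suc x ^ n) ≋ + (x ^ n) + 1ℤ) (ℕ.suc-pred p)
    (subst (λ y → + (y ^ p′) ≋ + (x ^ p′) + 1ℤ) (ℕ.+-comm x 1) (freshman′ (ℕ.pred p) (ℕ.suc-pred p) x))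
    where p′ = suc (ℕ.pred p)

  fermat-pow : ∀ x → + (x ^ p) ≋ + x
  fermat-pow zero = ≋-reflexive (cong +_ (subst (λ n → 0 ^ n ≡ 0) (ℕ.suc-pred p) refl))
  fermat-pow (suc x) = begin
    + (suc x ^ p)     ≈⟨ freshman x ⟩
    + (x ^ p) + 1ℤ    ≈⟨ +-cong (fermat-pow x) (≋-refl {1ℤ}) ⟩
    + x + 1ℤ          ≡⟨ ℤ.pos-+ x 1 ⟨
    + (x ℕ.+ 1)       ≡⟨ cong +_ (ℕ.+-comm x 1) ⟩
    + suc x           ∎
    where open ≋-Reasoning

  fermat : ∀ {z} → + z ≉ 0ℤ → + (z ^ ℕ.pred p) ≋ 1ℤ
  fermat {z} z≉0 = *-cancelˡ-≋ z≉0 (begin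
    + z * + (z ^ ℕ.pred p)   ≡⟨ ℤ.pos-* z (z ^ ℕ.pred p) ⟨
    + (z ^ suc (ℕ.pred p))   ≡⟨ cong (λ n → + (z ^ n)) (ℕ.suc-pred p) ⟩
    + (z ^ p)                ≈⟨ fermat-pow z ⟩
    + z                      ≡⟨ ℤ.*-identityʳ (+ z) ⟨
    + z * 1ℤ                 ∎)
    where open ≋-Reasoning

  inv-inverse : ∀ {z} → + z ≉ 0ℤ → + z * + Fp.inv p z ≋ 1ℤ
  inv-inverse {z} z≉0 = begin
    + z * + Fp.inv p z          ≈⟨ *-cong (≋-refl {+ z}) (%≋ (z ^ (p ℕ.∸ 2))) ⟩
    + z * + (z ^ (p ℕ.∸ 2))     ≡⟨ ℤ.pos-* z _ ⟨
    + (z ^ suc (p ℕ.∸ 2))       ≡⟨ cong (λ n → + (z ^ n)) 1+[p∸2]≡pred-p ⟩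
    + (z ^ ℕ.pred p)            ≈⟨ fermat z≉0 ⟩
    1ℤ                          ∎
    where
      open ≋-Reasoning
      1+[n∸2]≡pred-n : ∀ n → 1 ℕ.< n → suc (n ℕ.∸ 2) ≡ ℕ.pred n
      1+[n∸2]≡pred-n (suc (suc _)) _ = refl
      1+[n∸2]≡pred-n 1 (s≤s ())
      1+[p∸2]≡pred-p : suc (p ℕ.∸ 2) ≡ ℕ.pred p
      1+[p∸2]≡pred-p = 1+[n∸2]≡pred-n p (ℕ.nonTrivial⇒n>1 p)

  square-quotient : ∀ {u e c} → e ≉ 0ℤ → u * u ≋ e * e * c → Σ ℤ λ v → v * v ≋ c
  square-quotient {u} {e} {c} e≉0 u²≋e²c = u * e⁻¹ , (begin
    (u * e⁻¹) * (u * e⁻¹)          ≡⟨ lemma₁ u e⁻¹ ⟩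
    (u * u) * (e⁻¹ * e⁻¹)          ≈⟨ *-cong u²≋e²c (≋-refl {e⁻¹ * e⁻¹}) ⟩
    (e * e * c) * (e⁻¹ * e⁻¹)      ≡⟨ lemma₂ e c e⁻¹ ⟩
    (e * e⁻¹) * (e * e⁻¹) * c      ≈⟨ *-cong (*-cong ee⁻¹≋1 ee⁻¹≋1) (≋-refl {c}) ⟩
    1ℤ * 1ℤ * c                    ≡⟨ ℤ.*-identityˡ c ⟩
    c                              ∎)
    where
      open ≋-Reasoning
      e⁻¹ : ℤ
      e⁻¹ = + Fp.inv p (rep e)
      ee⁻¹≋1 : e * e⁻¹ ≋ 1ℤ
      ee⁻¹≋1 = ≋-trans (*-cong (≋-sym (rep≋ e)) (≋-refl {e⁻¹})) (inv-inverse (λ r≋0 → e≉0 (≋-trans (≋-sym (rep≋ e)) r≋0)))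
      lemma₁ : ∀ u i → (u * i) * (u * i) ≡ (u * u) * (i * i)
      lemma₁ = solve-∀
      lemma₂ : ∀ e c i → (e * e * c) * (i * i) ≡ (e * i) * (e * i) * c
      lemma₂ = solve-∀

module CubeRootOfUnity (p : ℕ) {{_ : NonZero p}} (p-prime : Prime p) where
  open Congruence p
  open PrimeField p p-prime
  open Fermat p p-prime using (fermat)
  open Polynomial

  private
    eval-≋0 : ∀ {cs} x → All (_≋ 0ℤ) cs → eval cs x ≋ 0ℤ
    eval-≋0 x [] = ≋-refl
    eval-≋0 x (c≋0 ∷ cs≋0) = ≋-trans (+-cong c≋0 (*-zeroʳ-≋ x (eval-≋0 x cs≋0))) (≋-reflexive refl)

    constant-≋0 : ∀ {c cs} r → eval (c ∷ cs) r ≋ 0ℤ → All (_≋ 0ℤ) cs → c ≋ 0ℤ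
    constant-≋0 {c} {cs} r root cs≋0 =
      ≋-trans (≋-reflexive (lemma c (r * eval cs r))) (≋-trans (-cong root (*-zeroʳ-≋ r (eval-≋0 r cs≋0))) (≋-reflexive refl))
      where lemma : ∀ c e → c ≡ (c + e) - e
            lemma = solve-∀

    quotient-≋0 : ∀ r cs → All (_≋ 0ℤ) (quotient r cs) → All (_≋ 0ℤ) cs
    quotient-≋0 r [] _ = []
    quotient-≋0 r (d ∷ ds) (root ∷ q≋0) = let ds≋0 = quotient-≋0 r ds q≋0 in constant-≋0 r root ds≋0 ∷ ds≋0

    quotient-root : ∀ {c cs r s} → eval (c ∷ cs) r ≋ 0ℤ → eval (c ∷ cs) s ≋ 0ℤ → r ≉ s → eval (quotient r cs) s ≋ 0ℤ
    quotient-root {c} {cs} {r} {s} r-root s-root r≉s =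
      [ ⊥-elim ∘ r≉s ∘ ≋-sym ∘ ≋-diff , id ]′
        (≋0-product (≋-trans (≋-reflexive (sym (eval-factor r c cs s))) (≋-trans (-cong s-root r-root) (≋-reflexive refl))))

  lagrange-root-bound : ∀ f rs → length rs ≡ length f → AllPairs _≉_ rs → All (λ s → eval f s ≋ 0ℤ) rs → All (_≋ 0ℤ) f
  lagrange-root-bound [] _ _ _ _ = []
  lagrange-root-bound (c ∷ cs) (r ∷ rs) |rs|≡|f| (r≉rs ∷ rs-distinct) (r-root ∷ rs-roots) =
    constant-≋0 r r-root cs≋0 ∷ cs≋0
    where
      q-roots : All (λ s → eval (quotient r cs) s ≋ 0ℤ) rs
      q-roots = All.zipWith (λ (s-root , r≉s) → quotient-root {c} {cs} r-root s-root r≉s) (rs-roots , r≉rs)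
      cs≋0 : All (_≋ 0ℤ) cs
      cs≋0 = quotient-≋0 r cs (lagrange-root-bound (quotient r cs) rs
        (trans (ℕ.suc-injective |rs|≡|f|) (sym (length-quotient r cs))) rs-distinct q-roots)

  primitive-cube-root : ∀ {W} → W * W * W ≋ 1ℤ → W ≉ 1ℤ → W * W + W + 1ℤ ≋ 0ℤ
  primitive-cube-root {W} W³≋1 W≉1 =
    [ ⊥-elim ∘ W≉1 ∘ ≋-diff , id ]′ (≋0-product (≋-trans (≋-reflexive (lemma W)) (diff-≋ W³≋1)))
    where lemma : ∀ W → (W - 1ℤ) * (W * W + W + 1ℤ) ≡ W * W * W - 1ℤ
          lemma = solve-∀

  private
    ^-cube : ∀ t m → t ^ m ℕ.* t ^ m ℕ.* t ^ m ≡ t ^ (3 ℕ.* m)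
    ^-cube t m = begin
      t ^ m ℕ.* t ^ m ℕ.* t ^ m    ≡⟨ cong (ℕ._* t ^ m) (ℕ.^-distribˡ-+-* t m m) ⟨
      t ^ (m ℕ.+ m) ℕ.* t ^ m      ≡⟨ ℕ.^-distribˡ-+-* t (m ℕ.+ m) m ⟨
      t ^ (m ℕ.+ m ℕ.+ m)          ≡⟨ cong (t ^_) (lemma m) ⟩
      t ^ (3 ℕ.* m)                ∎
      where
        open ≡-Reasoning
        lemma : ∀ m → m ℕ.+ m ℕ.+ m ≡ 3 ℕ.* m
        lemma = ℕSolver.solve-∀

    X^[1+_]-1 : ℕ → List ℤ
    X^[1+ k ]-1 = -1ℤ ∷ monomial k

    eval-X^[1+k]-1 : ∀ k t → eval X^[1+ k ]-1 (+ t) ≡ -1ℤ + + (t ^ suc k)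
    eval-X^[1+k]-1 k t = cong (λ e → -1ℤ + e) (trans (cong (+ t *_) (eval-monomial k t)) (sym (ℤ.pos-* t (t ^ k))))

    leading-coefficient : ∀ k → All (_≋ 0ℤ) X^[1+ k ]-1 → 1ℤ ≋ 0ℤ
    leading-coefficient k (_ ∷ coefficients≋0) = go k coefficients≋0
      where
        go : ∀ k → All (_≋ 0ℤ) (monomial k) → 1ℤ ≋ 0ℤ
        go zero (1≋0 ∷ _) = 1≋0
        go (suc k) (_ ∷ rest) = go k rest

    sample : ℕ → ℤ
    sample i = + suc i

  -- X^m - 1 has at most m roots, so one of the m + 1 residues 1, …, m + 1 is not a root.
  non-root-of-X^m-1 : ∀ k → suc (suc k) ℕ.< p → Σ ℕ λ t → 0 ℕ.< t × t ℕ.< p × + (t ^ suc k) ≉ 1ℤ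
  non-root-of-X^m-1 k m+1<p with All.all? (λ s → eval X^[1+ k ]-1 s ≋? 0ℤ) (applyUpTo sample (suc (suc k)))
  ... | yes all-roots = ⊥-elim (1≉0 (leading-coefficient k
        (lagrange-root-bound X^[1+ k ]-1 (applyUpTo sample (suc (suc k))) |samples|≡|f| samples-distinct all-roots)))
    where
      |samples|≡|f| : length (applyUpTo sample (suc (suc k))) ≡ length X^[1+ k ]-1
      |samples|≡|f| = trans (List.length-applyUpTo sample (suc (suc k))) (cong suc (sym (length-monomial k)))
      samples-distinct : AllPairs _≉_ (applyUpTo sample (suc (suc k)))
      samples-distinct = AllPairsP.applyUpTo⁺₁ sample (suc (suc k)) λ {i} {j} i<j j<m+1 i≋j →
        ℕ.<-irrefl (ℕ.suc-injective (≋⇒≡ (ℕ.<-trans (s≤s i<j) (ℕ.≤-<-trans j<m+1 m+1<p)) (ℕ.≤-<-trans j<m+1 m+1<p) i≋j)) i<j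
  ... | no ¬all-roots with Any.applyUpTo⁻ sample (AllP.¬All⇒Any¬ (λ s → eval X^[1+ k ]-1 s ≋? 0ℤ) (applyUpTo sample (suc (suc k))) ¬all-roots)
  ...   | i , i<m+1 , non-root = suc i , ℕ.z<s , ℕ.≤-<-trans i<m+1 m+1<p ,
          λ t^m≋1 → non-root (≋-trans (≋-reflexive (eval-X^[1+k]-1 k (suc i))) (≋-trans (+-cong (≋-refl { -1ℤ }) t^m≋1) (≋-reflexive refl)))

  cube-root-of-unity : ∀ m → ℕ.pred p ≡ 3 ℕ.* m → Σ ℤ λ ω → ω * ω + ω + 1ℤ ≋ 0ℤ
  cube-root-of-unity zero p-1≡0 = ⊥-elim (ℕ.<-irrefl (trans (cong suc (sym p-1≡0)) (ℕ.suc-pred p)) (ℕ.nonTrivial⇒n>1 p))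
  cube-root-of-unity m@(suc k) p-1≡3m =
    let t , 0<t , t<p , t^m≉1 = non-root-of-X^m-1 k m+1<p
    in + (t ^ m) , primitive-cube-root (W³≋1 t 0<t t<p) t^m≉1
    where
      m+1<p : suc m ℕ.< p
      m+1<p = subst (suc m ℕ.<_) (trans (cong suc (sym p-1≡3m)) (ℕ.suc-pred p))
                (s≤s (s≤s (ℕ.≤-trans (ℕ.m≤n+m (suc k) k) (ℕ.+-monoʳ-≤ k (ℕ.m≤m+n (suc k) _)))))
      W³≋1 : ∀ t → 0 ℕ.< t → t ℕ.< p → + (t ^ m) * + (t ^ m) * + (t ^ m) ≋ 1ℤ
      W³≋1 t 0<t t<p = begin
        + (t ^ m) * + (t ^ m) * + (t ^ m)   ≡⟨ pos-cube (t ^ m) ⟩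
        + (t ^ m ℕ.* t ^ m ℕ.* t ^ m)       ≡⟨ cong +_ (trans (^-cube t m) (cong (t ^_) (sym p-1≡3m))) ⟩
        + (t ^ ℕ.pred p)                    ≈⟨ fermat (<p⇒≉0 0<t t<p) ⟩
        1ℤ                                  ∎
        where open ≋-Reasoning

module RootCounts (p : ℕ) {{_ : NonZero p}} (p-prime : Prime p) where
  open Congruence p
  open PrimeField p p-prime
  open Counting

  #square-roots : ℤ → ℕ
  #square-roots c = count (λ y → + (y ℕ.* y) ≋? c) (upTo p)

  #square-roots-cong : ∀ {c c′} → c ≋ c′ → #square-roots c ≡ #square-roots c′
  #square-roots-cong c≋c′ = count-cong _ _ (All.universal (λ _ → ≋-rhs⇔ c≋c′) (upTo p))

  #square-roots-nonsquare : ∀ {c} → (∀ v → v * v ≉ c) → #square-roots c ≡ 0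
  #square-roots-nonsquare {c} nonsquare =
    count-none _ (All.universal (λ y y²≋c → nonsquare (+ y) (≋-trans (≋-reflexive (sym (ℤ.pos-* y y))) y²≋c)) (upTo p))

  #square-roots-square : + 2 ≉ 0ℤ → ∀ {c} s → c ≉ 0ℤ → s * s ≋ c → #square-roots c ≡ 2
  #square-roots-square 2≉0 {c} s c≉0 s²≋c =
    count-upTo-≡-length _ (rep s ∷ rep (- s) ∷ []) ((rep-s≢rep[-s] ∷ []) ∷ [] ∷ []) (rep<p s ∷ rep<p (- s) ∷ []) roots
    where
      rep-s≢rep[-s] : rep s ≢ rep (- s)
      rep-s≢rep[-s] eq = c≉0 (≋-trans (≋-sym s²≋c) (*-zeroʳ-≋ s s≋0))
        where
          s≋-s : s ≋ - s
          s≋-s = ≋-trans (≋-sym (rep≋ s)) (≋-trans (≋-reflexive (cong +_ eq)) (rep≋ (- s)))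
          s≋0 : s ≋ 0ℤ
          s≋0 = [ ⊥-elim ∘ 2≉0 , id ]′ (≋0-product (≋-trans (≋-reflexive (lemma s)) (diff-≋ s≋-s)))
            where lemma : ∀ s → + 2 * s ≡ s - - s
                  lemma = solve-∀
      square-rep : ∀ z → + (rep z ℕ.* rep z) ≋ z * z
      square-rep z = ≋-trans (≋-reflexive (ℤ.pos-* (rep z) (rep z))) (*-cong (rep≋ z) (rep≋ z))
      roots : ∀ {y} → y ℕ.< p → (+ (y ℕ.* y) ≋ c) ⇔ y ∈ rep s ∷ rep (- s) ∷ []
      roots {y} y<p = mk⇔
        (λ y²≋c → [ here ∘ ≋⇒≡rep y<p , there ∘ here ∘ ≋⇒≡rep y<p ]′
          (≋-square-roots {s} (≋-trans (square-rep′ y) (≋-trans y²≋c (≋-sym s²≋c)))))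
        λ { (here refl) → ≋-trans (square-rep s) s²≋c
          ; (there (here refl)) → ≋-trans (square-rep (- s)) (≋-trans (≋-reflexive (lemma s)) s²≋c) }
        where
          square-rep′ : ∀ y → + y * + y ≋ + (y ℕ.* y)
          square-rep′ y = ≋-reflexive (sym (ℤ.pos-* y y))
          lemma : ∀ s → - s * - s ≡ s * s
          lemma = solve-∀

  #cube-roots : ℤ → ℕ
  #cube-roots c = count (λ x → + (x ℕ.* x ℕ.* x) ≋? c) (upTo p)

  module PrimitiveCubeRoot {ω} (ω²+ω+1≋0 : ω * ω + ω + 1ℤ ≋ 0ℤ) (3≉0 : + 3 ≉ 0ℤ) where

    ω³≋1 : ω * ω * ω ≋ 1ℤ
    ω³≋1 = ≋-diff (≋-trans (≋-reflexive (lemma ω)) (*-zeroʳ-≋ (ω - 1ℤ) ω²+ω+1≋0))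
      where lemma : ∀ ω → ω * ω * ω - 1ℤ ≡ (ω - 1ℤ) * (ω * ω + ω + 1ℤ)
            lemma = solve-∀

    ω≉1 : ω ≉ 1ℤ
    ω≉1 ω≋1 = 3≉0 (≋-trans (≋-sym (+-cong (+-cong (*-cong ω≋1 ω≋1) ω≋1) (≋-refl {1ℤ}))) ω²+ω+1≋0)

    ω≉0 : ω ≉ 0ℤ
    ω≉0 ω≋0 = 1≉0 (≋-trans (≋-sym (+-cong (+-cong (*-cong ω≋0 ω≋0) ω≋0) (≋-refl {1ℤ}))) ω²+ω+1≋0)

    ω²≉1 : ω * ω ≉ 1ℤ
    ω²≉1 ω²≋1 = ω≉1 (begin
      ω               ≡⟨ ℤ.*-identityʳ ω ⟨
      ω * 1ℤ          ≈⟨ *-cong (≋-refl {ω}) ω²≋1 ⟨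
      ω * (ω * ω)     ≡⟨ ℤ.*-assoc ω ω ω ⟨
      ω * ω * ω       ≈⟨ ω³≋1 ⟩
      1ℤ              ∎)
      where open ≋-Reasoning

    cube-roots-factor : ∀ x a → (x - a) * (x - a * ω) * (x - a * ω * ω) ≋ x * x * x - a * a * a
    cube-roots-factor x a = begin
      (x - a) * (x - a * ω) * (x - a * ω * ω)                     ≡⟨ lemma x a ω ⟩
      (x * x * x - a * a * a) + (ω * ω + ω + 1ℤ) * r x a ω          ≈⟨ +-cong (≋-refl {x * x * x - a * a * a}) (*-cong ω²+ω+1≋0 (≋-refl {r x a ω})) ⟩
      (x * x * x - a * a * a) + 0ℤ * r x a ω                       ≡⟨ cong (λ t → x * x * x - a * a * a + t) (ℤ.*-zeroˡ (r x a ω)) ⟩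
      (x * x * x - a * a * a) + 0ℤ                                ≡⟨ ℤ.+-identityʳ _ ⟩
      x * x * x - a * a * a                                       ∎
      where
        open ≋-Reasoning
        r : ℤ → ℤ → ℤ → ℤ
        r x a ω = - (a * x * x) + a * a * x * ω - a * a * a * (ω - 1ℤ)
        lemma : ∀ x a ω → (x - a) * (x - a * ω) * (x - a * ω * ω)
                        ≡ (x * x * x - a * a * a) + (ω * ω + ω + 1ℤ) * (- (a * x * x) + a * a * x * ω - a * a * a * (ω - 1ℤ))
        lemma = solve-∀

    private
      cancel-to-1 : ∀ {a w} → a ≉ 0ℤ → a ≋ a * w → w ≋ 1ℤ
      cancel-to-1 {a} {w} a≉0 a≋aw = ≋-sym (*-cancelˡ-≋ a≉0 (≋-trans (≋-reflexive (ℤ.*-identityʳ a)) a≋aw))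

      rep-injective : ∀ {u v} → rep u ≡ rep v → u ≋ v
      rep-injective {u} {v} eq = ≋-trans (≋-sym (rep≋ u)) (≋-trans (≋-reflexive (cong +_ eq)) (rep≋ v))

      cube-rep : ∀ z → + (rep z ℕ.* rep z ℕ.* rep z) ≋ z * z * z
      cube-rep z = ≋-trans (≋-reflexive (sym (pos-cube (rep z)))) (*-cong (*-cong (rep≋ z) (rep≋ z)) (rep≋ z))

    [aω]³≋a³ : ∀ a → (a * ω) * (a * ω) * (a * ω) ≋ a * a * a
    [aω]³≋a³ a = begin
      (a * ω) * (a * ω) * (a * ω)   ≡⟨ lemma a ω ⟩
      a * a * a * (ω * ω * ω)       ≈⟨ *-cong (≋-refl {a * a * a}) ω³≋1 ⟩
      a * a * a * 1ℤ                ≡⟨ ℤ.*-identityʳ (a * a * a) ⟩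
      a * a * a                     ∎
      where
        open ≋-Reasoning
        lemma : ∀ a ω → (a * ω) * (a * ω) * (a * ω) ≡ a * a * a * (ω * ω * ω)
        lemma = solve-∀

    cube-roots : ℕ → List ℕ
    cube-roots a = a ∷ rep (+ a * ω) ∷ rep (+ a * ω * ω) ∷ []

    cube-roots-distinct : ∀ {a} → + a ≉ 0ℤ → AllPairs _≢_ (cube-roots a)
    cube-roots-distinct {a} a≉0 = (a≢aω ∷ a≢aω² ∷ []) ∷ (aω≢aω² ∷ []) ∷ [] ∷ []
      where
        A : ℤ
        A = + a
        a≢aω : a ≢ rep (A * ω)
        a≢aω eq = ω≉1 (cancel-to-1 a≉0 (≋-trans (≋-reflexive (cong +_ eq)) (rep≋ (A * ω))))
        a≢aω² : a ≢ rep (A * ω * ω)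
        a≢aω² eq = ω²≉1 (cancel-to-1 a≉0 (≋-trans (≋-reflexive (cong +_ eq)) (≋-trans (rep≋ (A * ω * ω)) (≋-reflexive (ℤ.*-assoc A ω ω)))))
        aω≢aω² : rep (A * ω) ≢ rep (A * ω * ω)
        aω≢aω² eq = ω≉1 (cancel-to-1 (*-≉0 a≉0 ω≉0) (rep-injective eq))

    ∈-cube-roots⇔ : ∀ {a x} → a ℕ.< p → x ℕ.< p → (+ (x ℕ.* x ℕ.* x) ≋ + (a ℕ.* a ℕ.* a)) ⇔ x ∈ cube-roots a
    ∈-cube-roots⇔ {a} {x} a<p x<p = mk⇔ to from
      where
        A : ℤ
        A = + a
        X : ℤ
        X = + x
        to : + (x ℕ.* x ℕ.* x) ≋ + (a ℕ.* a ℕ.* a) → x ∈ cube-roots a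
        to x³≋a³ = [ [ here ∘ ≋⇒≡ x<p a<p ∘ ≋-diff , there ∘ here ∘ ≋⇒≡rep {z = A * ω} x<p ∘ ≋-diff ]′ ∘ ≋0-product
                   , there ∘ there ∘ here ∘ ≋⇒≡rep {z = A * ω * ω} x<p ∘ ≋-diff ]′ (≋0-product product≋0)
          where
            product≋0 : (X - A) * (X - A * ω) * (X - A * ω * ω) ≋ 0ℤ
            product≋0 = ≋-trans (cube-roots-factor X A)
              (diff-≋ (≋-trans (≋-reflexive (pos-cube x)) (≋-trans x³≋a³ (≋-reflexive (sym (pos-cube a))))))
        from : x ∈ cube-roots a → + (x ℕ.* x ℕ.* x) ≋ + (a ℕ.* a ℕ.* a)
        from (here refl) = ≋-refl
        from (there (here refl)) = ≋-trans (cube-rep (A * ω)) (≋-trans ([aω]³≋a³ A) (≋-reflexive (pos-cube a)))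
        from (there (there (here refl))) =
          ≋-trans (cube-rep (A * ω * ω)) (≋-trans ([aω]³≋a³ (A * ω)) (≋-trans ([aω]³≋a³ A) (≋-reflexive (pos-cube a))))

    #cube-roots-of-cube : ∀ {a c} → a ℕ.< p → + (a ℕ.* a ℕ.* a) ≋ c → c ≉ 0ℤ → #cube-roots c ≡ 3
    #cube-roots-of-cube {a} {c} a<p a³≋c c≉0 =
      count-upTo-≡-length _ (cube-roots a) (cube-roots-distinct a≉0) (a<p ∷ rep<p (+ a * ω) ∷ rep<p (+ a * ω * ω) ∷ [])
        (λ x<p → ⇔-trans (≋-rhs⇔ (≋-sym a³≋c)) (∈-cube-roots⇔ a<p x<p))
      where
        a≉0 : + a ≉ 0ℤ
        a≉0 a≋0 = c≉0 (≋-trans (≋-sym a³≋c) (≋-trans (≋-reflexive (sym (pos-cube a))) (*-zeroʳ-≋ (+ a * + a) a≋0)))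

    #cube-roots-0-or-3 : ∀ {c} → c ≉ 0ℤ → #cube-roots c ≡ 0 ⊎ #cube-roots c ≡ 3
    #cube-roots-0-or-3 {c} c≉0 with AnyR.any? (λ x → + (x ℕ.* x ℕ.* x) ≋? c) (upTo p)
    ... | no no-root = inj₁ (count-none _ (AllP.¬Any⇒All¬ (upTo p) no-root))
    ... | yes some-root with Any.applyUpTo⁻ id some-root
    ...   | a , a<p , a³≋c = inj₂ (#cube-roots-of-cube a<p a³≋c c≉0)

module TangentConstruction (p : ℕ) {{_ : NonZero p}} (p-prime : Prime p) (3<p : 3 ℕ.< p) where
  open Congruence p
  open PrimeField p p-prime
  open Fermat p p-prime using (inv-inverse)
  open Fp p using (Pt; ∞; aff; _+E_; triple; _⊗_; _⊘_; _⊖_)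

  2≉0 : + 2 ≉ 0ℤ
  2≉0 = <p⇒≉0 ℕ.z<s (ℕ.<-trans (ℕ.n<1+n 2) 3<p)

  3≉0 : + 3 ≉ 0ℤ
  3≉0 = <p⇒≉0 ℕ.z<s 3<p

  slope : ℕ → ℕ → ℕ
  slope x y = (3 ⊗ x ⊗ x) ⊘ (2 ⊗ y)

  x[2P] : ℕ → ℕ → ℕ
  x[2P] x y = (slope x y ⊗ slope x y) ⊖ x ⊖ x

  y[2P] : ℕ → ℕ → ℕ
  y[2P] x y = (slope x y ⊗ (x ⊖ x[2P] x y)) ⊖ y

  double : ∀ x y → (y ℕ.+ y) % p ≢ 0 → aff x y +E aff x y ≡ aff (x[2P] x y) (y[2P] x y)
  double x y 2y≢0 with x % p ℕ.≟ x % p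
  ... | no x≢x = ⊥-elim (x≢x refl)
  ... | yes _ with (y ℕ.+ y) % p ℕ.≟ 0
  ...   | yes 2y≡0 = ⊥-elim (2y≢0 2y≡0)
  ...   | no _ = refl

  double-2-torsion : ∀ x y → (y ℕ.+ y) % p ≡ 0 → aff x y +E aff x y ≡ ∞
  double-2-torsion x y 2y≡0 with x % p ℕ.≟ x % p
  ... | no x≢x = ⊥-elim (x≢x refl)
  ... | yes _ with (y ℕ.+ y) % p ℕ.≟ 0
  ...   | yes _ = refl
  ...   | no 2y≢0 = ⊥-elim (2y≢0 2y≡0)

  chord-affine : ∀ x₁ y₁ x₂ y₂ → x₁ % p ≢ x₂ % p → aff x₁ y₁ +E aff x₂ y₂ ≢ ∞
  chord-affine x₁ y₁ x₂ y₂ x₁≢x₂ with x₁ % p ℕ.≟ x₂ % p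
  ... | yes x₁≡x₂ = ⊥-elim (x₁≢x₂ x₁≡x₂)
  ... | no _ = λ ()

  add-opposite : ∀ x₁ y₁ x₂ y₂ → x₁ % p ≡ x₂ % p → (y₁ ℕ.+ y₂) % p ≡ 0 → aff x₁ y₁ +E aff x₂ y₂ ≡ ∞
  add-opposite x₁ y₁ x₂ y₂ x₁≡x₂ y₁+y₂≡0 with x₁ % p ℕ.≟ x₂ % p
  ... | no x₁≢x₂ = ⊥-elim (x₁≢x₂ x₁≡x₂)
  ... | yes _ with (y₁ ℕ.+ y₂) % p ℕ.≟ 0
  ...   | yes _ = refl
  ...   | no y₁+y₂≢0 = ⊥-elim (y₁+y₂≢0 y₁+y₂≡0)

  private
    y[2P]≋-y : ∀ x y → x % p ≡ x[2P] x y % p → + y[2P] x y ≋ - + y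
    y[2P]≋-y x y x≡x₂ = begin
      + y[2P] x y                                  ≈⟨ ⊖≋- _ y ⟩
      + (slope x y ⊗ (x ⊖ x[2P] x y)) - + y        ≈⟨ -cong (⊗≋* (slope x y) _) (≋-refl {+ y}) ⟩
      + slope x y * + (x ⊖ x[2P] x y) - + y        ≈⟨ -cong (*-cong (≋-refl {+ slope x y}) (⊖≋- x (x[2P] x y))) (≋-refl {+ y}) ⟩
      + slope x y * (+ x - + x[2P] x y) - + y      ≈⟨ -cong (*-zeroʳ-≋ (+ slope x y) (diff-≋ (%≡⇒≋ x≡x₂))) (≋-refl {+ y}) ⟩
      0ℤ - + y                                     ≡⟨ ℤ.+-identityˡ (- + y) ⟩
      - + y                                        ∎
      where open ≋-Reasoning

  -- 3P = O means 2P = -P; when 2P is affine, equal x-coordinates already force it.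
  triple≡∞⇔ : ∀ x y → triple (aff x y) ≡ ∞ ⇔ ((y ℕ.+ y) % p ≢ 0 × x % p ≡ x[2P] x y % p)
  triple≡∞⇔ x y = mk⇔ to from
    where
      to : triple (aff x y) ≡ ∞ → (y ℕ.+ y) % p ≢ 0 × x % p ≡ x[2P] x y % p
      to 3P≡∞ with (y ℕ.+ y) % p ℕ.≟ 0
      ... | yes 2y≡0 with () ← trans (cong (aff x y +E_) (sym (double-2-torsion x y 2y≡0))) 3P≡∞
      ... | no 2y≢0 with x % p ℕ.≟ x[2P] x y % p
      ...   | yes x≡x₂ = 2y≢0 , x≡x₂
      ...   | no x≢x₂ = ⊥-elim (chord-affine x y _ _ x≢x₂ (trans (cong (aff x y +E_) (sym (double x y 2y≢0))) 3P≡∞))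
      from : (y ℕ.+ y) % p ≢ 0 × x % p ≡ x[2P] x y % p → triple (aff x y) ≡ ∞
      from (2y≢0 , x≡x₂) = trans (cong (aff x y +E_) (double x y 2y≢0))
        (add-opposite x y (x[2P] x y) (y[2P] x y) x≡x₂ (≋0⇒%≡0 y+y[2P]≋0))
        where
          y+y[2P]≋0 : + (y ℕ.+ y[2P] x y) ≋ 0ℤ
          y+y[2P]≋0 = ≋-trans (≋-reflexive (ℤ.pos-+ y (y[2P] x y)))
            (≋-trans (+-cong (≋-refl {+ y}) (y[2P]≋-y x y x≡x₂)) (≋-reflexive (ℤ.+-inverseʳ (+ y))))

  2y≢0⇔y≉0 : ∀ y → (y ℕ.+ y) % p ≢ 0 ⇔ + y ≉ 0ℤ
  2y≢0⇔y≉0 y = mk⇔ (λ 2y≢0 y≋0 → 2y≢0 (≋0⇒%≡0 (2y≋0 y≋0))) (λ y≉0 2y≡0 → y≉0 (y≋0 (%≡0⇒≋0 2y≡0)))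
    where
      lemma : ∀ a → + 2 * a ≡ a + a
      lemma = solve-∀
      2y≋0 : + y ≋ 0ℤ → + (y ℕ.+ y) ≋ 0ℤ
      2y≋0 y≋0 = ≋-trans (≋-reflexive (ℤ.pos-+ y y)) (≋-trans (+-cong y≋0 y≋0) ≋-refl)
      y≋0 : + (y ℕ.+ y) ≋ 0ℤ → + y ≋ 0ℤ
      y≋0 2y≋0 = [ ⊥-elim ∘ 2≉0 , id ]′ (≋0-product (≋-trans (≋-reflexive (trans (lemma (+ y)) (sym (ℤ.pos-+ y y)))) 2y≋0))

  slope-equation : ∀ x y → + y ≉ 0ℤ → + slope x y * (+ 2 * + y) ≋ + 3 * (+ x * + x)
  slope-equation x y y≉0 = begin
    + slope x y * (+ 2 * + y)                 ≈⟨ *-cong (⊗≋* (3 ⊗ x ⊗ x) (Fp.inv p w)) (≋-sym (⊗≋* 2 y)) ⟩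
    + (3 ⊗ x ⊗ x) * + Fp.inv p w * + w        ≡⟨ lemma (+ (3 ⊗ x ⊗ x)) (+ Fp.inv p w) (+ w) ⟩
    + (3 ⊗ x ⊗ x) * (+ w * + Fp.inv p w)      ≈⟨ *-cong (≋-refl {+ (3 ⊗ x ⊗ x)}) (inv-inverse w≉0) ⟩
    + (3 ⊗ x ⊗ x) * 1ℤ                        ≈⟨ *-cong (≋-trans (⊗≋* (3 ⊗ x) x) (*-cong (⊗≋* 3 x) (≋-refl {+ x}))) (≋-refl {1ℤ}) ⟩
    + 3 * + x * + x * 1ℤ                      ≡⟨ lemma′ (+ x) ⟩
    + 3 * (+ x * + x)                         ∎
    where
      open ≋-Reasoning
      w : ℕ
      w = 2 ⊗ y
      w≉0 : + w ≉ 0ℤ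
      w≉0 w≋0 = *-≉0 2≉0 y≉0 (≋-trans (≋-sym (⊗≋* 2 y)) w≋0)
      lemma : ∀ a b c → a * b * c ≡ a * (c * b)
      lemma = solve-∀
      lemma′ : ∀ x → + 3 * x * x * 1ℤ ≡ + 3 * (x * x)
      lemma′ = solve-∀

  x≡x[2P]⇔ : ∀ x y → x % p ≡ x[2P] x y % p ⇔ + slope x y * + slope x y ≋ + 3 * + x
  x≡x[2P]⇔ x y = mk⇔
    (λ x≡x₂ → ≋-diff (≋-trans (≋-reflexive (lemma₁ L X)) (diff-≋ (≋-sym (≋-trans (%≡⇒≋ x≡x₂) x₂≋)))))
    (λ L²≋3X → ≋⇒%≡ (≋-sym (≋-trans x₂≋ (≋-diff (≋-trans (≋-reflexive (lemma₂ L X)) (diff-≋ L²≋3X))))))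
    where
      L : ℤ
      L = + slope x y
      X : ℤ
      X = + x
      x₂≋ : + x[2P] x y ≋ L * L - X - X
      x₂≋ = ≋-trans (⊖≋- _ x) (-cong (≋-trans (⊖≋- _ x) (-cong (⊗≋* (slope x y) (slope x y)) (≋-refl {X}))) (≋-refl {X}))
      lemma₁ : ∀ L X → L * L - + 3 * X ≡ (L * L - X - X) - X
      lemma₁ = solve-∀
      lemma₂ : ∀ L X → (L * L - X - X) - X ≡ L * L - + 3 * X
      lemma₂ = solve-∀

  -- Eliminating L from L·2Y = 3X² and Y² = X³ + B gives (2Y)²(L² - 3X) = -3X(X³ + 4B).
  tangent-criterion : ∀ {L X Y B} → L * (+ 2 * Y) ≋ + 3 * (X * X) → Y * Y ≋ X * X * X + B → Y ≉ 0ℤ →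
                      L * L ≋ + 3 * X ⇔ (X ≋ 0ℤ ⊎ X * X * X ≋ - (+ 4 * B))
  tangent-criterion {L} {X} {Y} {B} slope-eq curve-eq Y≉0 = mk⇔ to from
    where
      2Y : ℤ
      2Y = + 2 * Y
      elimination : 2Y * 2Y * (L * L - + 3 * X) ≋ - (+ 3 * (X * (X * X * X + + 4 * B)))
      elimination = begin
        2Y * 2Y * (L * L - + 3 * X)                                    ≡⟨ lemma₁ L X Y ⟩
        (L * 2Y) * (L * 2Y) - + 4 * (Y * Y) * (+ 3 * X)                ≈⟨ -cong (*-cong slope-eq slope-eq) (*-cong (*-cong (≋-refl {+ 4}) curve-eq) (≋-refl {+ 3 * X})) ⟩
        + 3 * (X * X) * (+ 3 * (X * X)) - + 4 * (X * X * X + B) * (+ 3 * X) ≡⟨ lemma₂ X B ⟩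
        - (+ 3 * (X * (X * X * X + + 4 * B)))                          ∎
        where
          open ≋-Reasoning
          lemma₁ : ∀ L X Y → (+ 2 * Y) * (+ 2 * Y) * (L * L - + 3 * X) ≡ (L * (+ 2 * Y)) * (L * (+ 2 * Y)) - + 4 * (Y * Y) * (+ 3 * X)
          lemma₁ = solve-∀
          lemma₂ : ∀ X B → + 3 * (X * X) * (+ 3 * (X * X)) - + 4 * (X * X * X + B) * (+ 3 * X) ≡ - (+ 3 * (X * (X * X * X + + 4 * B)))
          lemma₂ = solve-∀
      cubic⇔ : X * X * X + + 4 * B ≋ 0ℤ ⇔ X * X * X ≋ - (+ 4 * B)
      cubic⇔ = mk⇔ (λ h → ≋-diff (≋-trans (≋-reflexive (lemma (X * X * X) (+ 4 * B))) h))
                   (λ h → ≋-trans (≋-reflexive (sym (lemma (X * X * X) (+ 4 * B)))) (diff-≋ h))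
        where lemma : ∀ a b → a - - b ≡ a + b
              lemma = solve-∀
      to : L * L ≋ + 3 * X → X ≋ 0ℤ ⊎ X * X * X ≋ - (+ 4 * B)
      to L²≋3X = Sum.map₂ (Equivalence.to cubic⇔) ([ ⊥-elim ∘ 3≉0 , ≋0-product ]′ (≋0-product 3X[X³+4B]≋0))
        where
          3X[X³+4B]≋0 : + 3 * (X * (X * X * X + + 4 * B)) ≋ 0ℤ
          3X[X³+4B]≋0 = ≋-trans (≋-reflexive (sym (ℤ.neg-involutive _)))
            (-‿cong (≋-trans (≋-sym elimination) (*-zeroʳ-≋ (2Y * 2Y) (diff-≋ L²≋3X))))
      from : X ≋ 0ℤ ⊎ X * X * X ≋ - (+ 4 * B) → L * L ≋ + 3 * X
      from h = ≋-diff ([ ⊥-elim ∘ *-≉0 2Y≉0 2Y≉0 , id ]′ (≋0-product (≋-trans elimination (-‿cong (*-zeroʳ-≋ (+ 3) X[X³+4B]≋0)))))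
        where
          2Y≉0 : 2Y ≉ 0ℤ
          2Y≉0 = *-≉0 2≉0 Y≉0
          X[X³+4B]≋0 : X * (X * X * X + + 4 * B) ≋ 0ℤ
          X[X³+4B]≋0 = [ (λ X≋0 → ≋-trans (*-cong X≋0 (≋-refl {X * X * X + + 4 * B})) (≋-reflexive (ℤ.*-zeroˡ (X * X * X + + 4 * B))))
                       , (λ X³≋-4B → *-zeroʳ-≋ X (Equivalence.from cubic⇔ X³≋-4B)) ]′ h

  order-3-criterion : ∀ {B} x y → B ≉ 0ℤ → + (y ℕ.* y) ≋ + (x ℕ.* x ℕ.* x) + B →
                      Fp.HasOrder3 p (aff x y) ⇔ (+ x ≋ 0ℤ ⊎ + (x ℕ.* x ℕ.* x) ≋ - (+ 4 * B))
  order-3-criterion {B} x y B≉0 curve-eq = mk⇔ to from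
    where
      X : ℤ
      X = + x
      X³≋ : X * X * X ≋ + (x ℕ.* x ℕ.* x)
      X³≋ = ≋-reflexive (pos-cube x)
      curve-eq′ : + y * + y ≋ X * X * X + B
      curve-eq′ = ≋-trans (≋-reflexive (sym (ℤ.pos-* y y))) (≋-trans curve-eq (+-cong (≋-sym X³≋) (≋-refl {B})))
      criterion : + y ≉ 0ℤ → + slope x y * + slope x y ≋ + 3 * X ⇔ (X ≋ 0ℤ ⊎ X * X * X ≋ - (+ 4 * B))
      criterion y≉0 = tangent-criterion {L = + slope x y} (slope-equation x y y≉0) curve-eq′ y≉0
      to : Fp.HasOrder3 p (aff x y) → X ≋ 0ℤ ⊎ + (x ℕ.* x ℕ.* x) ≋ - (+ 4 * B)
      to (_ , 3P≡∞) with Equivalence.to (triple≡∞⇔ x y) 3P≡∞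
      ... | 2y≢0 , x≡x₂ = Sum.map₂ (≋-trans (≋-sym X³≋)) (Equivalence.to (criterion y≉0) (Equivalence.to (x≡x[2P]⇔ x y) x≡x₂))
        where y≉0 = Equivalence.to (2y≢0⇔y≉0 y) 2y≢0
      from : X ≋ 0ℤ ⊎ + (x ℕ.* x ℕ.* x) ≋ - (+ 4 * B) → Fp.HasOrder3 p (aff x y)
      from h = (λ ()) , Equivalence.from (triple≡∞⇔ x y)
        (Equivalence.from (2y≢0⇔y≉0 y) y≉0 , Equivalence.from (x≡x[2P]⇔ x y) (Equivalence.from (criterion y≉0) h′))
        where
          h′ : X ≋ 0ℤ ⊎ X * X * X ≋ - (+ 4 * B)
          h′ = Sum.map₂ (≋-trans X³≋) h
          y≉0 : + y ≉ 0ℤ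
          y≉0 y≋0 = [ (λ X≋0 → B≉0 (≋-trans (≋-reflexive (lemma₁ X B)) (≋-trans (-cong X³+B≋0 (*-cong (*-cong X≋0 X≋0) X≋0)) (≋-reflexive refl))))
                    , (λ X³≋-4B → *-≉0 3≉0 B≉0 (≋-trans (≋-reflexive (lemma₂ X B))
                        (≋-trans (-cong (≋-trans (+-cong X³≋-4B (≋-refl {+ 4 * B})) (≋-reflexive (ℤ.+-inverseˡ (+ 4 * B)))) X³+B≋0) (≋-reflexive refl)))) ]′ h′
            where
              X³+B≋0 : X * X * X + B ≋ 0ℤ
              X³+B≋0 = ≋-trans (≋-sym curve-eq′) (≋-trans (*-cong y≋0 y≋0) (≋-reflexive refl))
              lemma₁ : ∀ X B → B ≡ (X * X * X + B) - X * X * X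
              lemma₁ = solve-∀
              lemma₂ : ∀ X B → + 3 * B ≡ (X * X * X + + 4 * B) - (X * X * X + B)
              lemma₂ = solve-∀

module Order3Count (p : ℕ) {{_ : NonZero p}} (p-prime : Prime p) (3<p : 3 ℕ.< p) (b : ℕ) (b≉0 : Congruence._≉_ p (+ b) 0ℤ) where
  open Congruence p
  open PrimeField p p-prime
  open RootCounts p p-prime
  open TangentConstruction p p-prime 3<p
  open Counting
  open Fp p using (aff; hasOrder3?; numOrder3; points)

  B : ℤ
  B = + b

  x≋0? : ∀ x → Dec (+ x ≋ 0ℤ)
  x≋0? x = + x ≋? 0ℤ

  cube≋-4B? : ∀ x → Dec (+ (x ℕ.* x ℕ.* x) ≋ - (+ 4 * B))
  cube≋-4B? x = + (x ℕ.* x ℕ.* x) ≋? - (+ 4 * B)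

  column : ℕ → ℕ
  column x = count (λ y → ((y ℕ.* y) % p ℕ.≟ (x ℕ.* x ℕ.* x ℕ.+ b) % p) ×-dec hasOrder3? (aff x y)) (upTo p)

  private
    x≋0⇒x³≋0 : ∀ {x} → + x ≋ 0ℤ → + (x ℕ.* x ℕ.* x) ≋ 0ℤ
    x≋0⇒x³≋0 {x} x≋0 = ≋-trans (≋-reflexive (sym (pos-cube x))) (*-zeroʳ-≋ (+ x * + x) x≋0)

  order-3-point⇔ : ∀ x y → ((y ℕ.* y) % p ≡ (x ℕ.* x ℕ.* x ℕ.+ b) % p × Fp.HasOrder3 p (aff x y))
                           ⇔ ((+ x ≋ 0ℤ ⊎ + (x ℕ.* x ℕ.* x) ≋ - (+ 4 * B)) × + (y ℕ.* y) ≋ + (x ℕ.* x ℕ.* x) + B)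
  order-3-point⇔ x y = mk⇔
    (λ (on-curve , order-3) → let eq = curve-≋ on-curve in Equivalence.to (order-3-criterion x y b≉0 eq) order-3 , eq)
    (λ (order-3 , eq) → ≋⇒%≡ (≋-trans eq (≋-reflexive (sym (ℤ.pos-+ _ b)))) , Equivalence.from (order-3-criterion x y b≉0 eq) order-3)
    where
      curve-≋ : (y ℕ.* y) % p ≡ (x ℕ.* x ℕ.* x ℕ.+ b) % p → + (y ℕ.* y) ≋ + (x ℕ.* x ℕ.* x) + B
      curve-≋ on-curve = ≋-trans (%≡⇒≋ on-curve) (≋-reflexive (ℤ.pos-+ _ b))

  column≡ : ∀ x → x ℕ.< p →
            column x ≡ indicator (x ℕ.≟ 0) (#square-roots B) ℕ.+ indicator (cube≋-4B? x) (#square-roots (- (+ 3) * B))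
  column≡ x x<p = begin
    column x
      ≡⟨ count-cong _ (λ y → order-3? ×-dec curve? y) (All.universal (order-3-point⇔ x) (upTo p)) ⟩
    count (λ y → order-3? ×-dec curve? y) (upTo p)
      ≡⟨ count-guarded order-3? curve? (upTo p) ⟩
    indicator order-3? N
      ≡⟨ indicator-⊎ (x≋0? x) (cube≋-4B? x) N disjoint ⟩
    indicator (x≋0? x) N ℕ.+ indicator (cube≋-4B? x) N
      ≡⟨ cong₂ ℕ._+_ (indicator-cong (x≋0? x) (x ℕ.≟ 0) x≋0⇔x≡0 (#square-roots-cong ∘ x≋0⇒rhs≋B))
                     (indicator-cong (cube≋-4B? x) (cube≋-4B? x) (mk⇔ id id) (#square-roots-cong ∘ x³≋-4B⇒rhs≋-3B)) ⟩
    indicator (x ℕ.≟ 0) (#square-roots B) ℕ.+ indicator (cube≋-4B? x) (#square-roots (- (+ 3) * B))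
      ∎
    where
      open ≡-Reasoning
      order-3? : Dec (+ x ≋ 0ℤ ⊎ + (x ℕ.* x ℕ.* x) ≋ - (+ 4 * B))
      order-3? = x≋0? x ⊎-dec cube≋-4B? x
      curve? : ∀ y → Dec (+ (y ℕ.* y) ≋ + (x ℕ.* x ℕ.* x) + B)
      curve? y = + (y ℕ.* y) ≋? + (x ℕ.* x ℕ.* x) + B
      N : ℕ
      N = #square-roots (+ (x ℕ.* x ℕ.* x) + B)
      disjoint : ¬ (+ x ≋ 0ℤ × + (x ℕ.* x ℕ.* x) ≋ - (+ 4 * B))
      disjoint (x≋0 , x³≋-4B) = *-≉0 (*-≉0 2≉0 2≉0) b≉0
        (≋-trans (≋-reflexive (sym (ℤ.neg-involutive _))) (-‿cong (≋-trans (≋-sym x³≋-4B) (x≋0⇒x³≋0 x≋0))))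
      x≋0⇔x≡0 : + x ≋ 0ℤ ⇔ x ≡ 0
      x≋0⇔x≡0 = mk⇔ (≋⇒≡ x<p (ℕ.>-nonZero⁻¹ p)) (λ { refl → ≋-refl })
      x≋0⇒rhs≋B : + x ≋ 0ℤ → + (x ℕ.* x ℕ.* x) + B ≋ B
      x≋0⇒rhs≋B x≋0 = ≋-trans (+-cong (x≋0⇒x³≋0 x≋0) (≋-refl {B})) (≋-reflexive (ℤ.+-identityˡ B))
      x³≋-4B⇒rhs≋-3B : + (x ℕ.* x ℕ.* x) ≋ - (+ 4 * B) → + (x ℕ.* x ℕ.* x) + B ≋ - (+ 3) * B
      x³≋-4B⇒rhs≋-3B x³≋-4B = ≋-trans (+-cong x³≋-4B (≋-refl {B})) (≋-reflexive (lemma B))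
        where lemma : ∀ B → - (+ 4 * B) + B ≡ - (+ 3) * B
              lemma = solve-∀

  -- The point at infinity does not have order 3; the affine points are counted column by column.
  numOrder3≡sum-columns : numOrder3 b ≡ sum (map column (upTo p))
  numOrder3≡sum-columns = trans (count-reject hasOrder3? (drop 1 (points b)) (λ (∞≢∞ , _) → ∞≢∞ refl)) (count-grid _ hasOrder3? _ (upTo p))

  numOrder3-formula : numOrder3 b ≡ #square-roots B ℕ.+ #cube-roots (- (+ 4 * B)) ℕ.* #square-roots (- (+ 3) * B)
  numOrder3-formula = begin
    numOrder3 b
      ≡⟨ numOrder3≡sum-columns ⟩
    sum (map column (upTo p))
      ≡⟨ sum-cong column _ (All.map (λ {x} → column≡ x) (AllP.all-upTo p)) ⟩
    sum (map (λ x → indicator (x ℕ.≟ 0) N₁ ℕ.+ indicator (cube≋-4B? x) N₃) (upTo p))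
      ≡⟨ sum-+ (λ x → indicator (x ℕ.≟ 0) N₁) (λ x → indicator (cube≋-4B? x) N₃) (upTo p) ⟩
    sum (map (λ x → indicator (x ℕ.≟ 0) N₁) (upTo p)) ℕ.+ sum (map (λ x → indicator (cube≋-4B? x) N₃) (upTo p))
      ≡⟨ cong₂ ℕ._+_ (sum-indicator (ℕ._≟ 0) N₁ (upTo p)) (sum-indicator cube≋-4B? N₃ (upTo p)) ⟩
    count (ℕ._≟ 0) (upTo p) ℕ.* N₁ ℕ.+ #cube-roots (- (+ 4 * B)) ℕ.* N₃
      ≡⟨ cong (λ n → n ℕ.* N₁ ℕ.+ #cube-roots (- (+ 4 * B)) ℕ.* N₃) (count-≡-upTo (ℕ.>-nonZero⁻¹ p)) ⟩
    1 ℕ.* N₁ ℕ.+ #cube-roots (- (+ 4 * B)) ℕ.* N₃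
      ≡⟨ cong (ℕ._+ #cube-roots (- (+ 4 * B)) ℕ.* N₃) (ℕ.*-identityˡ N₁) ⟩
    N₁ ℕ.+ #cube-roots (- (+ 4 * B)) ℕ.* N₃
      ∎
    where
      open ≡-Reasoning
      N₁ : ℕ
      N₁ = #square-roots B
      N₃ : ℕ
      N₃ = #square-roots (- (+ 3) * B)

≡1-mod-6⇒ : ∀ {p} → 1 ℕ.< p → p % 6 ≡ 1 → 3 ℕ.< p × Σ ℕ λ m → ℕ.pred p ≡ 3 ℕ.* m
≡1-mod-6⇒ {p} 1<p p%6≡1 = from-quotient (p / 6) (trans (m≡m%n+[m/n]*n p 6) (cong (ℕ._+ p / 6 ℕ.* 6) p%6≡1))
  where
    from-quotient : ∀ q → p ≡ 1 ℕ.+ q ℕ.* 6 → 3 ℕ.< p × Σ ℕ λ m → ℕ.pred p ≡ 3 ℕ.* m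
    from-quotient zero p≡1 = ⊥-elim (ℕ.<-irrefl (sym p≡1) 1<p)
    from-quotient (suc q) refl = s≤s (s≤s (s≤s (s≤s z≤n))) , 2 ℕ.* suc q , lemma q
      where lemma : ∀ q → suc q ℕ.* 6 ≡ 3 ℕ.* (2 ℕ.* suc q)
            lemma = ℕSolver.solve-∀

module CurveX³+a³ (p : ℕ) {{_ : NonZero p}} (p-prime : Prime p) (p%6≡1 : p % 6 ≡ 1) (a : ℕ) (a≢0 : a % p ≢ 0) where
  open Congruence p
  open PrimeField p p-prime
  open Fermat p p-prime using (square-quotient)
  open CubeRootOfUnity p p-prime using (cube-root-of-unity)
  open RootCounts p p-prime

  private
    mod-6 : 3 ℕ.< p × Σ ℕ λ m → ℕ.pred p ≡ 3 ℕ.* m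
    mod-6 = ≡1-mod-6⇒ (ℕ.nonTrivial⇒n>1 p) p%6≡1
    3<p : 3 ℕ.< p
    3<p = proj₁ mod-6
    cube-root : Σ ℤ λ ω → ω * ω + ω + 1ℤ ≋ 0ℤ
    cube-root = cube-root-of-unity (proj₁ (proj₂ mod-6)) (proj₂ (proj₂ mod-6))
    ω : ℤ
    ω = proj₁ cube-root

  open TangentConstruction p p-prime 3<p using (2≉0; 3≉0)
  open PrimitiveCubeRoot {ω} (proj₂ cube-root) 3≉0

  A B : ℤ
  A = + a
  B = + (a ^ 3)

  A≉0 : A ≉ 0ℤ
  A≉0 = a≢0 ∘ ≋0⇒%≡0

  B≋A³ : B ≋ A * A * A
  B≋A³ = ≋-reflexive (trans (cong +_ (lemma a)) (sym (pos-cube a)))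
    where lemma : ∀ a → a ℕ.* (a ℕ.* (a ℕ.* 1)) ≡ a ℕ.* a ℕ.* a
          lemma = ℕSolver.solve-∀

  B≉0 : B ≉ 0ℤ
  B≉0 B≋0 = *-≉0 (*-≉0 A≉0 A≉0) A≉0 (≋-trans (≋-sym B≋A³) B≋0)

  -3≋[2ω+1]² : - (+ 3) ≋ (+ 2 * ω + 1ℤ) * (+ 2 * ω + 1ℤ)
  -3≋[2ω+1]² = ≋-sym (≋-trans (≋-reflexive (lemma ω)) (≋-trans (+-cong (*-zeroʳ-≋ (+ 4) (proj₂ cube-root)) (≋-refl { - (+ 3) })) (≋-reflexive refl)))
    where lemma : ∀ ω → (+ 2 * ω + 1ℤ) * (+ 2 * ω + 1ℤ) ≡ + 4 * (ω * ω + ω + 1ℤ) + - (+ 3)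
          lemma = solve-∀

  open Order3Count p p-prime 3<p (a ^ 3) B≉0 using (numOrder3-formula)
  open Fp p using (numOrder3)

  IsSquare : Set
  IsSquare = Σ ℕ λ x → (x ℕ.* x) % p ≡ a % p

  square-≋ : IsSquare → Σ ℤ λ v → v * v ≋ A
  square-≋ (x , x²≡a) = + x , ≋-trans (≋-reflexive (sym (ℤ.pos-* x x))) (%≡⇒≋ x²≡a)

  ≋-square : Σ ℤ (λ v → v * v ≋ A) → IsSquare
  ≋-square (v , v²≋A) = rep v , ≋⇒%≡ (≋-trans (≋-reflexive (ℤ.pos-* (rep v) (rep v))) (≋-trans (*-cong (rep≋ v) (rep≋ v)) v²≋A))

  square? : Dec IsSquare
  square? with AnyR.any? (λ x → (x ℕ.* x) % p ℕ.≟ a % p) (upTo p)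
  ... | yes some = yes (let x , _ , x²≡a = Any.applyUpTo⁻ id some in x , x²≡a)
  ... | no none = no λ (x , x²≡a) → none (Any.applyUpTo⁺ id (proj₂ (≋-square (square-≋ (x , x²≡a)))) (rep<p (+ x)))

  private
    t : ℤ
    t = + 2 * ω + 1ℤ

    -4B≉0 : - (+ 4 * B) ≉ 0ℤ
    -4B≉0 -4B≋0 = *-≉0 (*-≉0 2≉0 2≉0) B≉0 (≋-trans (≋-reflexive (sym (ℤ.neg-involutive _))) (-‿cong -4B≋0))

    -3B≉0 : - (+ 3) * B ≉ 0ℤ
    -3B≉0 = *-≉0 (3≉0 ∘ ≋-trans (≋-reflexive (sym (ℤ.neg-involutive _))) ∘ -‿cong) B≉0

    -3B≋t²A³ : - (+ 3) * B ≋ (t * t) * (A * A * A)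
    -3B≋t²A³ = *-cong -3≋[2ω+1]² B≋A³

  numOrder3-square : IsSquare → numOrder3 (a ^ 3) ≡ 2 ⊎ numOrder3 (a ^ 3) ≡ 8
  numOrder3-square square = Sum.map (total 0) (total 3) (#cube-roots-0-or-3 -4B≉0)
    where
      s : ℤ
      s = proj₁ (square-≋ square)
      s²≋A : s * s ≋ A
      s²≋A = proj₂ (square-≋ square)
      [sA]²≋A³ : (s * A) * (s * A) ≋ A * A * A
      [sA]²≋A³ = ≋-trans (≋-reflexive (lemma s A)) (≋-trans (*-cong s²≋A (≋-refl {A * A})) (≋-reflexive (sym (ℤ.*-assoc A A A))))
        where lemma : ∀ s A → (s * A) * (s * A) ≡ s * s * (A * A)
              lemma = solve-∀
      #√B≡2 : #square-roots B ≡ 2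
      #√B≡2 = #square-roots-square 2≉0 (s * A) B≉0 (≋-trans [sA]²≋A³ (≋-sym B≋A³))
      #√-3B≡2 : #square-roots (- (+ 3) * B) ≡ 2
      #√-3B≡2 = #square-roots-square 2≉0 (t * (s * A)) -3B≉0
        (≋-trans (≋-reflexive (lemma t (s * A))) (≋-trans (*-cong (≋-refl {t * t}) [sA]²≋A³) (≋-sym -3B≋t²A³)))
        where lemma : ∀ t u → (t * u) * (t * u) ≡ (t * t) * (u * u)
              lemma = solve-∀
      total : ∀ k → #cube-roots (- (+ 4 * B)) ≡ k → numOrder3 (a ^ 3) ≡ 2 ℕ.+ k ℕ.* 2
      total k #∛≡k = trans numOrder3-formula (cong₂ ℕ._+_ #√B≡2 (cong₂ ℕ._*_ #∛≡k #√-3B≡2))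

  numOrder3-nonsquare : ¬ IsSquare → numOrder3 (a ^ 3) ≡ 0
  numOrder3-nonsquare nonsquare = begin
    numOrder3 (a ^ 3)                                                  ≡⟨ numOrder3-formula ⟩
    #square-roots B ℕ.+ #cube-roots (- (+ 4 * B)) ℕ.* #square-roots (- (+ 3) * B)
      ≡⟨ cong₂ (λ m n → m ℕ.+ #cube-roots (- (+ 4 * B)) ℕ.* n) (#square-roots-nonsquare (no-root B≋A³ A≉0)) (#square-roots-nonsquare (no-root -3B≋[tA]²A tA≉0)) ⟩
    0 ℕ.+ #cube-roots (- (+ 4 * B)) ℕ.* 0                              ≡⟨ ℕ.*-zeroʳ (#cube-roots (- (+ 4 * B))) ⟩
    0                                                                  ∎
    where
      open ≡-Reasoning
      -3B≋[tA]²A : - (+ 3) * B ≋ (t * A) * (t * A) * A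
      -3B≋[tA]²A = ≋-trans -3B≋t²A³ (≋-reflexive (lemma t A))
        where lemma : ∀ t A → (t * t) * (A * A * A) ≡ (t * A) * (t * A) * A
              lemma = solve-∀
      tA≉0 : t * A ≉ 0ℤ
      tA≉0 = *-≉0 (λ t≋0 → 3≉0 (≋-trans (-‿cong (≋-trans -3≋[2ω+1]² (*-zeroʳ-≋ t t≋0))) (≋-reflexive refl))) A≉0
      no-root : ∀ {c e} → c ≋ e * e * A → e ≉ 0ℤ → ∀ v → v * v ≉ c
      no-root c≋e²A e≉0 v v²≋c = nonsquare (≋-square (square-quotient {u = v} e≉0 (≋-trans v²≋c c≋e²A)))

2-or-8≢0 : ∀ {n} → n ≡ 2 ⊎ n ≡ 8 → n ≢ 0
2-or-8≢0 (inj₁ refl) ()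
2-or-8≢0 (inj₂ refl) ()

square-dichotomy : ∀ {Z S : Set} {n : ℕ} → Z → Dec S → (S → n ≡ 2 ⊎ n ≡ 8) → (¬ S → n ≡ 0) →
                   ((Z × S) ⇔ (n ≡ 2 ⊎ n ≡ 8)) × ((Z × ¬ S) ⇔ n ≡ 0)
square-dichotomy z (yes s) if-square _ =
  mk⇔ (λ _ → if-square s) (λ _ → z , s) , mk⇔ (λ (_ , ¬s) → ⊥-elim (¬s s)) (⊥-elim ∘ 2-or-8≢0 (if-square s))
square-dichotomy z (no ¬s) _ if-nonsquare =
  mk⇔ (λ (_ , s) → ⊥-elim (¬s s)) (λ 2-or-8 → ⊥-elim (2-or-8≢0 2-or-8 (if-nonsquare ¬s))) , mk⇔ (λ _ → if-nonsquare ¬s) (λ _ → z , ¬s)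

corollary16 : (p : ℕ) → {{_ : NonZero p}} → Prime p → p % 6 ≡ 1 →
    (a : ℕ) → a % p ≢ 0 →
    (Fp.IsQR p a ⇔ (Fp.numOrder3 p (a ^ 3) ≡ 2 ⊎ Fp.numOrder3 p (a ^ 3) ≡ 8))
    × (Fp.IsQNR p a ⇔ Fp.numOrder3 p (a ^ 3) ≡ 0)
corollary16 p p-prime p%6≡1 a a≢0 = square-dichotomy a≢0 square? numOrder3-square numOrder3-nonsquare
  where open CurveX³+a³ p p-prime p%6≡1 a a≢0
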